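{- Let $f$ be a real-valued symmetric function on $\{1,2,\dots\}^2$ such that $$g_f(1,1)>\max\Big\{g_f(1,2),\,g_f(2,2),\,\tfrac{g_f(1,2)+g_f(2,1)}{2}\Big\}.$$ Then: (a) If $g_f(1,1)>g_f(2)$, then for every $n\ge 3$, among all polyomino chains with $n$ squares, the linear chain $Li_n$ is the unique maximizer of $TI_f$. (b) If $g_f(1,1)=g_f(2)$, then for every $n\ge4$, $Li_n$ is the unique maximizer of $TI_f$ among polyomino chains with $n$ squares; and for $n=3$, $TI_f(PC(2))=TI_f(PC(1))$. (c) If $g_f(1,1)<g_f(2)$, let $n^*=\left\lceil \frac{g_f(2)-g_f(1,1)}{g_f(1,1)-g_f(2,2)}+3\right\rceil$. Then: (i) for $3\le n<n^*$, the zigzag chain $Z_n$ is the unique maximizer of $TI_f$ among polyomino chains with $n$ squares; (ii) for $n=n^*$, $Li_n$ attains the maximum of $TI_f$ (and possibly $Z_n$ does as well); (iii) for $n>n^*$, $Li_n$ is the unique maximizer of $TI_f$.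
   Context: Polyomino chains (restricted model). For $n\ge 2$, a polyomino chain with $n$ squares is a sequence of closed unit squares $S_1,\dots,S_n$ in the plane with $S_1=[0,1]\times[0,1]$, $S_2=[1,2]\times[0,1]$, and for $k\ge 3$, $S_k=S_{k-1}+v_k$, where $v_2=(1,0)$ and each $v_k\in\{(1,0),(0,-1)\}$ satisfies $v_k=v_{k-1}$ if $L_k=1$ and $v_k\neq v_{k-1}$ if $L_k=2$. For $n\ge3$ the chain is determined by its link vector $(L_3,\dots,L_n)\in\{1,2\}^{n-2}$ and denoted $PC(L_3,\dots,L_n)$; two chains are distinct iff their link vectors differ. The linear chain is $Li_n=PC(1,\dots,1)$ and the zigzag chain is $Z_n=PC(2,\dots,2)$. Each chain is regarded as the graph whose vertices are the corners of the squares and whose edges are the sides of the squares. For a real-valued symmetric $f$ on positive integers, $TI_f(G)=\sum_{uv\in E(G)} f(d_u,d_v)$, with $d_u$ the degree of $u$. Define $g_f(1,1)=3f(3,3)$, $g_f(1,2)=3f(3,4)+f(2,4)+f(2,3)-2f(3,3)$, $g_f(2,1)=f(3,4)-f(2,4)+f(2,3)+2f(3,3)$, $g_f(2,2)=f(4,4)+2f(2,4)$, $g_f(2)=2f(3,4)+2f(2,4)-f(3,3)$. -}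

module Defs where

open import Level using (0ℓ)
open import Data.Nat as ℕ using (ℕ; zero; suc)
open import Data.Integer as ℤ using (ℤ)
import Data.Integer.Properties as ℤP
open import Data.Product using (_×_; _,_; proj₁; proj₂)
open import Data.Product.Properties using (≡-dec)
open import Data.Sum using (_⊎_)
open import Data.List using (List; []; _∷_; _++_; map; foldr; filter; length; deduplicate; concatMap)
open import Data.Vec using (Vec; toList; replicate)
open import Relation.Nullary using (¬_)
open import Relation.Nullary.Decidable using (_⊎-dec_)
open import Relation.Binary.PropositionalEquality using (_≡_)
open import Algebra.Structures using (IsCommutativeRing)

record OrderedField : Set₁ where
  infixl 6 _+_ _-_
  infixl 7 _*_
  infix 8 -_
  infix 9 _⁻¹
  infix 4 _<_ _≤_
  field
    Carrier : Set
    _+_ _*_ : Carrier → Carrier → Carrier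
    -_ _⁻¹  : Carrier → Carrier
    0# 1#   : Carrier
    _<_     : Carrier → Carrier → Set
    isCommutativeRing : IsCommutativeRing _≡_ _+_ _*_ -_ 0# 1#
    ⁻¹-inverse : ∀ x → ¬ (x ≡ 0#) → x * x ⁻¹ ≡ 1#
    0≢1        : ¬ (0# ≡ 1#)
    <-irrefl   : ∀ x → ¬ (x < x)
    <-trans    : ∀ {x y z} → x < y → y < z → x < z
    <-trichotomy : ∀ x y → x < y ⊎ (x ≡ y ⊎ y < x)
    +-mono-<   : ∀ {x y} z → x < y → x + z < y + z
    *-pos      : ∀ {x y} → 0# < x → 0# < y → 0# < x * y

  _-_ : Carrier → Carrier → Carrier
  x - y = x + (- y)

  _≤_ : Carrier → Carrier → Set
  x ≤ y = x < y ⊎ x ≡ y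

  fromℕ : ℕ → Carrier
  fromℕ zero    = 0#
  fromℕ (suc n) = 1# + fromℕ n

data Link : Set where
  L1 L2 : Link

data Dir : Set where
  right down : Dir

Point : Set
Point = ℤ × ℤ

step : Point → Dir → Point
step (x , y) right = (x ℤ.+ ℤ.+ 1 , y)
step (x , y) down  = (x , y ℤ.- ℤ.+ 1)

newDir : Dir → Link → Dir
newDir d     L1 = d
newDir right L2 = down
newDir down  L2 = right

squaresFrom : Point → Dir → List Link → List Point
squaresFrom p d []       = []
squaresFrom p d (l ∷ ls) = let d' = newDir d l ; q = step p d' in q ∷ squaresFrom q d' ls

-- lower-left corners of S₁, …, Sₙ for PC(L₃,…,Lₙ)
squares : List Link → List Point
squares ls = (ℤ.+ 0 , ℤ.+ 0) ∷ (ℤ.+ 1 , ℤ.+ 0) ∷ squaresFrom (ℤ.+ 1 , ℤ.+ 0) right ls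

Edge : Set
Edge = Point × Point

_≟P_ : (p q : Point) → Relation.Nullary.Dec (p ≡ q)
_≟P_ = ≡-dec ℤP._≟_ ℤP._≟_

_≟E_ : (e e' : Edge) → Relation.Nullary.Dec (e ≡ e')
_≟E_ = ≡-dec _≟P_ _≟P_

sides : Point → List Edge
sides (x , y) =
  ((x , y) , (x ℤ.+ ℤ.+ 1 , y)) ∷
  ((x , y ℤ.+ ℤ.+ 1) , (x ℤ.+ ℤ.+ 1 , y ℤ.+ ℤ.+ 1)) ∷
  ((x , y) , (x , y ℤ.+ ℤ.+ 1)) ∷
  ((x ℤ.+ ℤ.+ 1 , y) , (x ℤ.+ ℤ.+ 1 , y ℤ.+ ℤ.+ 1)) ∷ []

edges : List Link → List Edge
edges ls = deduplicate _≟E_ (concatMap sides (squares ls))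

degree : List Link → Point → ℕ
degree ls v = length (filter (λ e → (v ≟P proj₁ e) ⊎-dec (v ≟P proj₂ e)) (edges ls))

module _ (F : OrderedField) where
  open OrderedField F

  TI : (ℕ → ℕ → Carrier) → List Link → Carrier
  TI f ls = foldr _+_ 0# (map (λ e → f (degree ls (proj₁ e)) (degree ls (proj₂ e))) (edges ls))

  UniqueMax : (ℕ → ℕ → Carrier) → (m : ℕ) → Vec Link m → Set
  UniqueMax f m L₀ = ∀ (L : Vec Link m) →
    (TI f (toList L) ≤ TI f (toList L₀)) × (TI f (toList L) ≡ TI f (toList L₀) → L ≡ L₀)

  AttainsMax : (ℕ → ℕ → Carrier) → (m : ℕ) → Vec Link m → Set
  AttainsMax f m L₀ = ∀ (L : Vec Link m) → TI f (toList L) ≤ TI f (toList L₀)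

  g11 g12 g21 g22 g2 : (ℕ → ℕ → Carrier) → Carrier
  g11 f = fromℕ 3 * f 3 3
  g12 f = fromℕ 3 * f 3 4 + f 2 4 + f 2 3 - fromℕ 2 * f 3 3
  g21 f = f 3 4 - f 2 4 + f 2 3 + fromℕ 2 * f 3 3
  g22 f = f 4 4 + fromℕ 2 * f 2 4
  g2  f = fromℕ 2 * f 3 4 + fromℕ 2 * f 2 4 - f 3 3

  IsCeiling : Carrier → ℕ → Set
  IsCeiling y k = (fromℕ k - 1# < y) × (y ≤ fromℕ k)

Li : (n : ℕ) → Vec Link (n ℕ.∸ 2)
Li n = replicate (n ℕ.∸ 2) L1

Z : (n : ℕ) → Vec Link (n ℕ.∸ 2)
Z n = replicate (n ℕ.∸ 2) L2

{-# OPTIONS --safe #-}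
module Submission where

-- Each link moves the chain one step along the diagonal coordinate x - y, so the squares added
-- by a new link change vertex degrees only within a window formed by the last few links.
-- Evaluating all windows gives the transfer formula
--   TI_f(PC(L₃, …, Lₙ)) = c + h(L₃) + Σₖ g_f(Lₖ, Lₖ₊₁),
-- where c = 2 f(2,2) + 4 f(2,3) + f(3,3), h(1) = g_f(1,1) and h(2) = g_f(2).
-- Under the hypotheses on g_f, every chain other than Li_n and Z_n has TI_f strictly below
-- TI_f(Li_n), so the maximiser is Li_n or Z_n, and the sign of
--   TI_f(Li_n) - TI_f(Z_n) = (n - 3) (g_f(1,1) - g_f(2,2)) - (g_f(2) - g_f(1,1))
-- decides between them.

open import Defs
open import Data.Nat as ℕ using (ℕ; _∸_)
open import Data.Product using (_×_)
open import Data.List using ([]; _∷_)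
open import Relation.Binary.PropositionalEquality using (_≡_)

open import Algebra.Bundles using (CommutativeRing)
import Algebra.Definitions.RawMonoid as RawMonoidDefinitions
import Algebra.Properties.AbelianGroup as AbelianGroupProperties
import Algebra.Properties.CommutativeMonoid.Mult as CommutativeMonoidMult
import Algebra.Properties.CommutativeSemigroup as CommutativeSemigroupProperties
import Algebra.Properties.Ring as RingProperties
import Algebra.Properties.Semiring.Mult as SemiringMult
open import Data.Bool using (true; false; if_then_else_)
open import Data.Empty using (⊥-elim)
open import Data.Integer as ℤ using (ℤ; 1ℤ)
import Data.Integer.Properties as ℤ
open import Data.Integer.Tactic.RingSolver using (solve-∀)
open import Data.List as List using (List; _++_; map; filter; foldr; length; concat; concatMap; deduplicate)
import Data.List.Properties as List
open import Data.List.Properties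
  using (filter-accept; filter-reject; filter-all; filter-++; filter-≐; filter-none; length-++; length-map;
         map-++; concat-++; concatMap-cong; concatMap-map; map-concatMap)
open import Data.List.Membership.Propositional using (_∈_; _∉_)
import Data.List.Membership.Propositional.Properties as ∈
import Data.List.Membership.DecPropositional as DecMembership
open import Data.List.Relation.Binary.Permutation.Propositional using (_↭_; ↭⇒↭ₛ; ↭ₛ⇒↭)
import Data.List.Relation.Binary.Permutation.Propositional.Properties as Perm
import Data.List.Relation.Binary.Permutation.Setoid.Properties as PermSetoid
open import Data.List.Relation.Unary.All as All using (All; []; _∷_; all?)
import Data.List.Relation.Unary.All.Properties as All
open import Data.List.Relation.Unary.Any as Any using (here; there)
open import Data.Nat as ℕ using (zero; suc; z≤n; s≤s; _≤ᵇ_)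
import Data.Nat.Properties as ℕ
open import Data.Product using (_,_; proj₁; proj₂; swap; uncurry)
import Data.Product.Properties as Product
open import Data.Product.Relation.Binary.Lex.NonStrict using (×-decTotalOrder)
open import Data.List.Sort.InsertionSort.Base (×-decTotalOrder ℕ.≤-decTotalOrder ℕ.≤-decTotalOrder) using (sort)
open import Data.List.Sort.InsertionSort.Properties (×-decTotalOrder ℕ.≤-decTotalOrder ℕ.≤-decTotalOrder) using (sort-↭)
open import Data.Sum as Sum using (_⊎_; inj₁; inj₂; [_,_])
open import Data.Vec using (Vec; []; _∷_; replicate; toList)
open import Function using (_∘_)
open import Function.Definitions using (Injective)
open import Level using (Level; 0ℓ)
open import Relation.Binary.Definitions using (DecidableEquality)
open import Relation.Binary.PropositionalEquality hiding ([_])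
import Relation.Binary.Construct.StrictToNonStrict as StrictToNonStrict
open import Relation.Nullary using (¬_; Dec; yes; no; ¬?)
open import Relation.Nullary.Decidable using (True; toWitness; map′; _×-dec_; _⊎-dec_)
open import Relation.Unary using (Pred; Decidable)
open import Relation.Unary.Properties using (_∩?_; ∁?)
open ≡-Reasoning

private variable
  p q : Level
  A B : Set

module _ {P : Pred A p} {Q : Pred A q} (P? : Decidable P) (Q? : Decidable Q) where

  filter-filter : ∀ xs → filter P? (filter Q? xs) ≡ filter (P? ∩? Q?) xs
  filter-filter [] = refl
  filter-filter (x ∷ xs) = by-cases (Q? x) (P? x)
    where
    by-cases : Dec (Q x) → Dec (P x) → filter P? (filter Q? (x ∷ xs)) ≡ filter (P? ∩? Q?) (x ∷ xs)
    by-cases (yes qx) (yes px) = begin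
      filter P? (filter Q? (x ∷ xs)) ≡⟨ cong (filter P?) (filter-accept Q? qx) ⟩
      filter P? (x ∷ filter Q? xs)   ≡⟨ filter-accept P? px ⟩
      x ∷ filter P? (filter Q? xs)   ≡⟨ cong (x ∷_) (filter-filter xs) ⟩
      x ∷ filter (P? ∩? Q?) xs       ≡⟨ filter-accept (P? ∩? Q?) (px , qx) ⟨
      filter (P? ∩? Q?) (x ∷ xs)     ∎
    by-cases (yes qx) (no ¬px) = begin
      filter P? (filter Q? (x ∷ xs)) ≡⟨ cong (filter P?) (filter-accept Q? qx) ⟩
      filter P? (x ∷ filter Q? xs)   ≡⟨ filter-reject P? ¬px ⟩
      filter P? (filter Q? xs)       ≡⟨ filter-filter xs ⟩
      filter (P? ∩? Q?) xs           ≡⟨ filter-reject (P? ∩? Q?) (¬px ∘ proj₁) ⟨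
      filter (P? ∩? Q?) (x ∷ xs)     ∎
    by-cases (no ¬qx) _ = begin
      filter P? (filter Q? (x ∷ xs)) ≡⟨ cong (filter P?) (filter-reject Q? ¬qx) ⟩
      filter P? (filter Q? xs)       ≡⟨ filter-filter xs ⟩
      filter (P? ∩? Q?) xs           ≡⟨ filter-reject (P? ∩? Q?) (¬qx ∘ proj₂) ⟨
      filter (P? ∩? Q?) (x ∷ xs)     ∎

filter-comm : {P : Pred A p} {Q : Pred A q} (P? : Decidable P) (Q? : Decidable Q) →
              ∀ xs → filter P? (filter Q? xs) ≡ filter Q? (filter P? xs)
filter-comm P? Q? xs = trans (filter-filter P? Q? xs) (trans (filter-≐ (P? ∩? Q?) (Q? ∩? P?) (swap , swap) xs)
  (sym (filter-filter Q? P? xs)))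

filter-map : {P : Pred B p} {Q : Pred A q} (P? : Decidable P) (Q? : Decidable Q) (φ : A → B) →
             ∀ {xs} → All (λ x → (P (φ x) → Q x) × (Q x → P (φ x))) xs →
             filter P? (map φ xs) ≡ map φ (filter Q? xs)
filter-map P? Q? φ [] = refl
filter-map {P = P} {Q = Q} P? Q? φ {x ∷ xs} ((to , from) ∷ rest) = by-cases (Q? x)
  where
  by-cases : Dec (Q x) → filter P? (map φ (x ∷ xs)) ≡ map φ (filter Q? (x ∷ xs))
  by-cases (yes qx) = begin
    filter P? (φ x ∷ map φ xs)   ≡⟨ filter-accept P? (from qx) ⟩
    φ x ∷ filter P? (map φ xs)   ≡⟨ cong (φ x ∷_) (filter-map P? Q? φ rest) ⟩
    φ x ∷ map φ (filter Q? xs)   ≡⟨ cong (map φ) (filter-accept Q? qx) ⟨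
    map φ (filter Q? (x ∷ xs))   ∎
  by-cases (no ¬qx) = begin
    filter P? (φ x ∷ map φ xs)   ≡⟨ filter-reject P? (¬qx ∘ to) ⟩
    filter P? (map φ xs)         ≡⟨ filter-map P? Q? φ rest ⟩
    map φ (filter Q? xs)         ≡⟨ cong (map φ) (filter-reject Q? ¬qx) ⟨
    map φ (filter Q? (x ∷ xs))   ∎

module _ (_≟_ : DecidableEquality A) where

  open DecMembership _≟_ using (_∉?_)

  private
    dedup : List A → List A
    dedup = deduplicate _≟_

    _≢?_ : ∀ x → Decidable (x ≢_)
    x ≢? y = ¬? (x ≟ y)

  deduplicate-filter : {P : Pred A p} (P? : Decidable P) → ∀ xs → filter P? (dedup xs) ≡ dedup (filter P? xs)
  deduplicate-filter P? [] = refl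
  deduplicate-filter {P = P} P? (x ∷ xs) = by-cases (P? x)
    where
    by-cases : Dec (P x) → filter P? (dedup (x ∷ xs)) ≡ dedup (filter P? (x ∷ xs))
    by-cases (yes px) = begin
      filter P? (x ∷ filter (x ≢?_) (dedup xs))   ≡⟨ filter-accept P? px ⟩
      x ∷ filter P? (filter (x ≢?_) (dedup xs))   ≡⟨ cong (x ∷_) (filter-comm P? (x ≢?_) (dedup xs)) ⟩
      x ∷ filter (x ≢?_) (filter P? (dedup xs))   ≡⟨ cong (λ ys → x ∷ filter (x ≢?_) ys) (deduplicate-filter P? xs) ⟩
      dedup (x ∷ filter P? xs)                    ≡⟨ cong dedup (filter-accept P? px) ⟨
      dedup (filter P? (x ∷ xs))                  ∎
    by-cases (no ¬px) = begin
      filter P? (x ∷ filter (x ≢?_) (dedup xs))   ≡⟨ filter-reject P? ¬px ⟩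
      filter P? (filter (x ≢?_) (dedup xs))       ≡⟨ filter-comm P? (x ≢?_) (dedup xs) ⟩
      filter (x ≢?_) (filter P? (dedup xs))       ≡⟨ cong (filter (x ≢?_)) (deduplicate-filter P? xs) ⟩
      filter (x ≢?_) (dedup (filter P? xs))       ≡⟨ filter-all (x ≢?_) (All.map (λ py x≡y → ¬px (subst P (sym x≡y) py))
                                                       (All.deduplicate⁺ _≟_ (All.all-filter P? xs))) ⟩
      dedup (filter P? xs)                        ≡⟨ cong dedup (filter-reject P? ¬px) ⟨
      dedup (filter P? (x ∷ xs))                  ∎

  deduplicate-++ : ∀ xs ys → dedup (xs ++ ys) ≡ dedup xs ++ dedup (filter (_∉? xs) ys)
  deduplicate-++ [] ys = cong dedup (sym (filter-all (_∉? []) (All.universal (λ _ ()) ys)))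
  deduplicate-++ (x ∷ xs) ys = cong (x ∷_) (begin
    filter (x ≢?_) (dedup (xs ++ ys))
      ≡⟨ cong (filter (x ≢?_)) (deduplicate-++ xs ys) ⟩
    filter (x ≢?_) (dedup xs ++ dedup (filter (_∉? xs) ys))
      ≡⟨ filter-++ (x ≢?_) (dedup xs) _ ⟩
    filter (x ≢?_) (dedup xs) ++ filter (x ≢?_) (dedup (filter (_∉? xs) ys))
      ≡⟨ cong (filter (x ≢?_) (dedup xs) ++_) (deduplicate-filter (x ≢?_) (filter (_∉? xs) ys)) ⟩
    filter (x ≢?_) (dedup xs) ++ dedup (filter (x ≢?_) (filter (_∉? xs) ys))
      ≡⟨ cong (λ zs → filter (x ≢?_) (dedup xs) ++ dedup zs) (trans (filter-filter (x ≢?_) (_∉? xs) ys)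
           (filter-≐ ((x ≢?_) ∩? (_∉? xs)) (_∉? (x ∷ xs)) (∉-∷ , ∉-∷⁻) ys)) ⟩
    filter (x ≢?_) (dedup xs) ++ dedup (filter (_∉? (x ∷ xs)) ys) ∎)
    where
    ∉-∷ : ∀ {y} → x ≢ y × y ∉ xs → y ∉ x ∷ xs
    ∉-∷ (x≢y , y∉xs) (here y≡x) = x≢y (sym y≡x)
    ∉-∷ (x≢y , y∉xs) (there y∈xs) = y∉xs y∈xs
    ∉-∷⁻ : ∀ {y} → y ∉ x ∷ xs → x ≢ y × y ∉ xs
    ∉-∷⁻ y∉ = (λ x≡y → y∉ (here (sym x≡y))) , (y∉ ∘ there)

deduplicate-map : (_≟ᴬ_ : DecidableEquality A) (_≟ᴮ_ : DecidableEquality B) (φ : A → B) →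
                  Injective _≡_ _≡_ φ → ∀ xs → deduplicate _≟ᴮ_ (map φ xs) ≡ map φ (deduplicate _≟ᴬ_ xs)
deduplicate-map _≟ᴬ_ _≟ᴮ_ φ φ-inj [] = refl
deduplicate-map _≟ᴬ_ _≟ᴮ_ φ φ-inj (x ∷ xs) = cong (φ x ∷_) (begin
  filter (λ y → ¬? (φ x ≟ᴮ y)) (deduplicate _≟ᴮ_ (map φ xs))
    ≡⟨ cong (filter (λ y → ¬? (φ x ≟ᴮ y))) (deduplicate-map _≟ᴬ_ _≟ᴮ_ φ φ-inj xs) ⟩
  filter (λ y → ¬? (φ x ≟ᴮ y)) (map φ (deduplicate _≟ᴬ_ xs))
    ≡⟨ filter-map (λ y → ¬? (φ x ≟ᴮ y)) (λ y → ¬? (x ≟ᴬ y)) φ {deduplicate _≟ᴬ_ xs}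
         (All.universal (λ y → (λ φx≢φy x≡y → φx≢φy (cong φ x≡y)) , (λ x≢y φx≡φy → x≢y (φ-inj φx≡φy))) _) ⟩
  map φ (filter (λ y → ¬? (x ≟ᴬ y)) (deduplicate _≟ᴬ_ xs)) ∎)

open DecMembership _≟E_ using (_∈?_; _∉?_)

Incident : Point → Edge → Set
Incident v e = v ≡ proj₁ e ⊎ v ≡ proj₂ e

incident? : ∀ v → Decidable (Incident v)
incident? v e = (v ≟P proj₁ e) ⊎-dec (v ≟P proj₂ e)

degreeIn : List Edge → Point → ℕ
degreeIn X v = length (filter (incident? v) X)

degreeIn-++ : ∀ X Y v → degreeIn (X ++ Y) v ≡ degreeIn X v ℕ.+ degreeIn Y v
degreeIn-++ X Y v = trans (cong length (filter-++ (incident? v) X Y)) (length-++ (filter (incident? v) X))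

degreeIn-none : ∀ {X v} → All (¬_ ∘ Incident v) X → degreeIn X v ≡ 0
degreeIn-none {v = v} none = cong length (filter-none (incident? v) none)

degreeIn-filter : ∀ {Q : Pred Edge 0ℓ} (Q? : Decidable Q) X v → (∀ {e} → Incident v e → Q e) →
                  degreeIn (filter Q? X) v ≡ degreeIn X v
degreeIn-filter Q? X v inc⇒Q = cong length (trans (filter-filter (incident? v) Q? X)
  (filter-≐ (incident? v ∩? Q?) (incident? v) (proj₁ , λ i → i , inc⇒Q i) X))

translate : Point → Point → Point
translate (a , b) (x , y) = (x ℤ.+ a , y ℤ.+ b)

translateEdge : Point → Edge → Edge
translateEdge p (u , w) = (translate p u , translate p w)

origin : Point
origin = (ℤ.+ 0 , ℤ.+ 0)

translate-origin : ∀ p → translate p origin ≡ p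
translate-origin (a , b) = cong₂ _,_ (ℤ.+-identityˡ a) (ℤ.+-identityˡ b)

untranslate : Point → Point → Point
untranslate (a , b) = translate (ℤ.- a , ℤ.- b)

translate-untranslate : ∀ p v → translate p (untranslate p v) ≡ v
translate-untranslate (a , b) (x , y) = cong₂ _,_ (cancel x a) (cancel y b)
  where cancel : ∀ x a → (x ℤ.+ ℤ.- a) ℤ.+ a ≡ x
        cancel = solve-∀

translate-injective : ∀ p {u w} → translate p u ≡ translate p w → u ≡ w
translate-injective (a , b) {x , y} {x' , y'} eq =
  cong₂ _,_ (∙-cancelʳ a x x' (cong proj₁ eq)) (∙-cancelʳ b y y' (cong proj₂ eq))
  where open AbelianGroupProperties ℤ.+-0-abelianGroup using (∙-cancelʳ)

translateEdge-injective : ∀ p {e e'} → translateEdge p e ≡ translateEdge p e' → e ≡ e'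
translateEdge-injective p {u , w} {u' , w'} eq =
  cong₂ _,_ (translate-injective p (cong proj₁ eq)) (translate-injective p (cong proj₂ eq))

private
  +-cancelʳ-≤ : ∀ {i j} k → i ℤ.+ k ℤ.≤ j ℤ.+ k → i ℤ.≤ j
  +-cancelʳ-≤ {i} {j} k h = subst₂ ℤ._≤_ (cancel i k) (cancel j k) (ℤ.+-monoˡ-≤ (ℤ.- k) h)
    where cancel : ∀ i k → (i ℤ.+ k) ℤ.- k ≡ i
          cancel = solve-∀
  +-+-comm : ∀ x a c → (x ℤ.+ a) ℤ.+ c ≡ (x ℤ.+ c) ℤ.+ a
  +-+-comm = solve-∀
  +--comm : ∀ x a c → (x ℤ.+ a) ℤ.- c ≡ (x ℤ.- c) ℤ.+ a
  +--comm = solve-∀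

step-translate : ∀ p q d → step (translate p q) d ≡ translate p (step q d)
step-translate (a , b) (x , y) right = cong (_, y ℤ.+ b) (+-+-comm x a (ℤ.+ 1))
step-translate (a , b) (x , y) down  = cong (x ℤ.+ a ,_) (+--comm y b (ℤ.+ 1))

sides-translate : ∀ p q → sides (translate p q) ≡ map (translateEdge p) (sides q)
sides-translate (a , b) (x , y) rewrite +-+-comm x a (ℤ.+ 1) | +-+-comm y b (ℤ.+ 1) = refl

squaresFrom-translate : ∀ p q d K → squaresFrom (translate p q) d K ≡ map (translate p) (squaresFrom q d K)
squaresFrom-translate p q d [] = refl
squaresFrom-translate p q d (l ∷ K) rewrite step-translate p q (newDir d l) =
  cong (_ ∷_) (squaresFrom-translate p _ _ K)

allSides-translate : ∀ p qs → concatMap sides (map (translate p) qs) ≡ map (translateEdge p) (concatMap sides qs)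
allSides-translate p qs = begin
  concatMap sides (map (translate p) qs)        ≡⟨ concatMap-map sides (translate p) qs ⟩
  concatMap (sides ∘ translate p) qs            ≡⟨ concatMap-cong (sides-translate p) qs ⟩
  concatMap (map (translateEdge p) ∘ sides) qs  ≡⟨ map-concatMap (translateEdge p) sides qs ⟨
  map (translateEdge p) (concatMap sides qs)    ∎

degreeIn-translate : ∀ p X u → degreeIn (map (translateEdge p) X) (translate p u) ≡ degreeIn X u
degreeIn-translate p X u = trans
  (cong length (filter-map (incident? (translate p u)) (incident? u) (translateEdge p)
    (All.universal (λ _ → incident-untranslate , Sum.map (cong (translate p)) (cong (translate p))) X)))
  (length-map (translateEdge p) (filter (incident? u) X))
  where
  incident-untranslate : ∀ {e} → Incident (translate p u) (translateEdge p e) → Incident u e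
  incident-untranslate = Sum.map (translate-injective p) (translate-injective p)

diag : Point → ℤ
diag (x , y) = x ℤ.- y

diag-translate : ∀ p u → diag (translate p u) ≡ diag u ℤ.+ diag p
diag-translate (a , b) (x , y) = rearrange x y a b
  where rearrange : ∀ x y a b → (x ℤ.+ a) ℤ.- (y ℤ.+ b) ≡ (x ℤ.- y) ℤ.+ (a ℤ.- b)
        rearrange = solve-∀

diag-step : ∀ q d → diag (step q d) ≡ ℤ.suc (diag q)
diag-step (x , y) right = rearrange x y
  where rearrange : ∀ x y → (x ℤ.+ ℤ.+ 1) ℤ.- y ≡ 1ℤ ℤ.+ (x ℤ.- y)
        rearrange = solve-∀
diag-step (x , y) down = rearrange x y
  where rearrange : ∀ x y → x ℤ.- (y ℤ.- ℤ.+ 1) ≡ 1ℤ ℤ.+ (x ℤ.- y)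
        rearrange = solve-∀

DiagAtMost : ℤ → Edge → Set
DiagAtMost k (u , w) = diag u ℤ.≤ k × diag w ℤ.≤ k

sides-diagAtMost : ∀ q → All (DiagAtMost (ℤ.suc (diag q))) (sides q)
sides-diagAtMost (x , y) =
  (at refl , above (shiftedRight x y)) ∷ (below (shiftedUp x y) , at (shiftedBoth x y)) ∷
  (at refl , below (shiftedUp x y)) ∷ (above (shiftedRight x y) , at (shiftedBoth x y)) ∷ []
  where
  i = x ℤ.- y
  at : ∀ {j} → j ≡ i → j ℤ.≤ ℤ.suc i
  at refl = ℤ.i≤suc[i] i
  above : ∀ {j} → j ≡ ℤ.suc i → j ℤ.≤ ℤ.suc i
  above = ℤ.≤-reflexive
  below : ∀ {j} → j ≡ i ℤ.- 1ℤ → j ℤ.≤ ℤ.suc i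
  below refl = ℤ.i≤j⇒i-k≤j 1ℤ (ℤ.i≤suc[i] i)
  shiftedRight : ∀ x y → (x ℤ.+ ℤ.+ 1) ℤ.- y ≡ 1ℤ ℤ.+ (x ℤ.- y)
  shiftedRight = solve-∀
  shiftedUp : ∀ x y → x ℤ.- (y ℤ.+ ℤ.+ 1) ≡ (x ℤ.- y) ℤ.- 1ℤ
  shiftedUp = solve-∀
  shiftedBoth : ∀ x y → (x ℤ.+ ℤ.+ 1) ℤ.- (y ℤ.+ ℤ.+ 1) ≡ x ℤ.- y
  shiftedBoth = solve-∀

chain : Point → Dir → List Link → List Point
chain p d K = p ∷ squaresFrom p d K

lastSquare : Point → Dir → List Link → Point
lastSquare p d []      = p
lastSquare p d (l ∷ K) = lastSquare (step p (newDir d l)) (newDir d l) K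

lastDir : Dir → List Link → Dir
lastDir d []      = d
lastDir d (l ∷ K) = lastDir (newDir d l) K

chainSides : Point → Dir → List Link → List Edge
chainSides p d K = concatMap sides (chain p d K)

chainEdges : Point → Dir → List Link → List Edge
chainEdges p d K = deduplicate _≟E_ (chainSides p d K)

allSides-++ : ∀ qs rs → concatMap sides (qs ++ rs) ≡ concatMap sides qs ++ concatMap sides rs
allSides-++ qs rs = trans (cong concat (map-++ sides qs rs)) (sym (concat-++ (map sides qs) (map sides rs)))

squaresFrom-++ : ∀ p d K W →
  squaresFrom p d (K ++ W) ≡ squaresFrom p d K ++ squaresFrom (lastSquare p d K) (lastDir d K) W
squaresFrom-++ p d []      W = refl
squaresFrom-++ p d (l ∷ K) W = cong (_ ∷_) (squaresFrom-++ _ _ K W)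

lastSquare∈chain : ∀ p d K → lastSquare p d K ∈ chain p d K
lastSquare∈chain p d []      = here refl
lastSquare∈chain p d (l ∷ K) = there (lastSquare∈chain _ _ K)

diag-lastSquare : ∀ p d K → diag p ℤ.≤ diag (lastSquare p d K)
diag-lastSquare p d []      = ℤ.≤-refl
diag-lastSquare p d (l ∷ K) =
  ℤ.≤-trans (ℤ.i≤suc[i] (diag p)) (ℤ.≤-trans (ℤ.≤-reflexive (sym (diag-step p (newDir d l)))) (diag-lastSquare _ _ K))

chain-diag : ∀ p d K → All (λ q → q ≡ lastSquare p d K ⊎ diag q ℤ.< diag (lastSquare p d K)) (chain p d K)
chain-diag p d []      = inj₁ refl ∷ []
chain-diag p d (l ∷ K) =
  inj₂ (ℤ.suc[i]≤j⇒i<j (ℤ.≤-trans (ℤ.≤-reflexive (sym (diag-step p (newDir d l)))) (diag-lastSquare _ _ K)))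
  ∷ chain-diag _ _ K

DiagAtMost-weaken : ∀ {j k} → j ℤ.≤ k → ∀ {e} → DiagAtMost j e → DiagAtMost k e
DiagAtMost-weaken j≤k (u≤j , w≤j) = ℤ.≤-trans u≤j j≤k , ℤ.≤-trans w≤j j≤k

∈-chainSides : ∀ p d K {e} → e ∈ chainSides p d K →
  e ∈ sides (lastSquare p d K) ⊎ DiagAtMost (diag (lastSquare p d K)) e
∈-chainSides p d K {e} e∈ =
  All.lookupWith classify (chain-diag p d K) (∈.∈-concatMap⁻ sides {xs = chain p d K} e∈)
  where
  L = lastSquare p d K
  classify : ∀ {q} → q ≡ L ⊎ diag q ℤ.< diag L → e ∈ sides q → e ∈ sides L ⊎ DiagAtMost (diag L) e
  classify (inj₁ refl) e∈q = inj₁ e∈q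
  classify {q} (inj₂ q<L) e∈q =
    inj₂ (DiagAtMost-weaken (ℤ.i<j⇒suc[i]≤j q<L) {e} (All.lookup (sides-diagAtMost q) e∈q))

chainEdges-diagAtMost : ∀ p d K → All (DiagAtMost (ℤ.suc (diag (lastSquare p d K)))) (chainEdges p d K)
chainEdges-diagAtMost p d K = All.deduplicate⁺ _≟E_ (All.tabulate (bound ∘ ∈-chainSides p d K))
  where
  L = lastSquare p d K
  bound : ∀ {e} → e ∈ sides L ⊎ DiagAtMost (diag L) e → DiagAtMost (ℤ.suc (diag L)) e
  bound (inj₁ e∈L)     = All.lookup (sides-diagAtMost L) e∈L
  bound {e} (inj₂ e≤L) = DiagAtMost-weaken (ℤ.i≤suc[i] (diag L)) {e} e≤L

sides-via-origin : ∀ q → sides q ≡ map (translateEdge q) (sides origin)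
sides-via-origin q = trans (cong sides (sym (translate-origin q))) (sides-translate q origin)

Ahead : Edge → Set
Ahead (u , w) = 1ℤ ℤ.≤ diag u ⊎ 1ℤ ℤ.≤ diag w

translated-side∈chainSides : ∀ p d K {e} → e ∈ sides origin → translateEdge (lastSquare p d K) e ∈ chainSides p d K
translated-side∈chainSides p d K {e} e∈ =
  ∈.∈-concatMap⁺ sides {xs = chain p d K} (Any.map (λ { refl → L-side }) (lastSquare∈chain p d K))
  where
  L = lastSquare p d K
  L-side : translateEdge L e ∈ sides L
  L-side = subst (translateEdge L e ∈_) (sym (sides-via-origin L)) (∈.∈-map⁺ (translateEdge L) e∈)

translated-ahead∈chainSides : ∀ p d K {e} → Ahead e →
  translateEdge (lastSquare p d K) e ∈ chainSides p d K → e ∈ sides origin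
translated-ahead∈chainSides p d K {e} ahead τe∈ = Sum.[ from-L-sides , ⊥-elim ∘ not-behind ] (∈-chainSides p d K τe∈)
  where
  L = lastSquare p d K
  from-L-sides : translateEdge L e ∈ sides L → e ∈ sides origin
  from-L-sides τe∈L =
    let e' , e'∈ , τe≡τe' = ∈.∈-map⁻ (translateEdge L) (subst (translateEdge L e ∈_) (sides-via-origin L) τe∈L)
    in subst (_∈ sides origin) (sym (translateEdge-injective L τe≡τe')) e'∈
  beyond : ∀ u → 1ℤ ℤ.≤ diag u → ¬ (diag (translate L u) ℤ.≤ diag L)
  beyond u 1≤u = ℤ.<⇒≱ (ℤ.suc[i]≤j⇒i<j (ℤ.≤-trans (ℤ.+-monoˡ-≤ (diag L) 1≤u) (ℤ.≤-reflexive (sym (diag-translate L u)))))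
  not-behind : ¬ DiagAtMost (diag L) (translateEdge L e)
  not-behind (u≤L , w≤L) = Sum.[ (λ 1≤u → beyond (proj₁ e) 1≤u u≤L) , (λ 1≤w → beyond (proj₂ e) 1≤w w≤L) ] ahead

windowSides : Dir → List Link → List Edge
windowSides d W = concatMap sides (squaresFrom origin d W)

windowEdges : Dir → List Link → List Edge
windowEdges d W = deduplicate _≟E_ (filter (_∉? sides origin) (windowSides d W))

WindowAhead : Dir → List Link → Set
WindowAhead d W = All (λ e → e ∈ sides origin ⊎ Ahead e) (windowSides d W)

chainEdges-++ : ∀ p d K W → WindowAhead (lastDir d K) W →
  chainEdges p d (K ++ W) ≡ chainEdges p d K ++ map (translateEdge (lastSquare p d K)) (windowEdges (lastDir d K) W)
chainEdges-++ p d K W ahead = begin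
  dedup (concatMap sides (p ∷ squaresFrom p d (K ++ W)))
    ≡⟨ cong (λ qs → dedup (concatMap sides (p ∷ qs))) (squaresFrom-++ p d K W) ⟩
  dedup (concatMap sides (chain p d K ++ squaresFrom L d₀ W))
    ≡⟨ cong dedup (allSides-++ (chain p d K) _) ⟩
  dedup (S ++ concatMap sides (squaresFrom L d₀ W))
    ≡⟨ cong (λ q → dedup (S ++ concatMap sides (squaresFrom q d₀ W))) (translate-origin L) ⟨
  dedup (S ++ concatMap sides (squaresFrom (translate L origin) d₀ W))
    ≡⟨ cong (λ es → dedup (S ++ es)) (trans (cong (concatMap sides) (squaresFrom-translate L origin d₀ W))
                                            (allSides-translate L (squaresFrom origin d₀ W))) ⟩
  dedup (S ++ map (translateEdge L) (windowSides d₀ W))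
    ≡⟨ deduplicate-++ _≟E_ S _ ⟩
  dedup S ++ dedup (filter (_∉? S) (map (translateEdge L) (windowSides d₀ W)))
    ≡⟨ cong (λ es → dedup S ++ dedup es) (filter-map (_∉? S) (_∉? sides origin) (translateEdge L) (All.map new⇔ ahead)) ⟩
  dedup S ++ dedup (map (translateEdge L) (filter (_∉? sides origin) (windowSides d₀ W)))
    ≡⟨ cong (dedup S ++_) (deduplicate-map _≟E_ _≟E_ (translateEdge L) (translateEdge-injective L) _) ⟩
  dedup S ++ map (translateEdge L) (windowEdges d₀ W) ∎
  where
  dedup = deduplicate _≟E_
  L = lastSquare p d K
  d₀ = lastDir d K
  S = chainSides p d K
  new⇔ : ∀ {e} → e ∈ sides origin ⊎ Ahead e →
         (translateEdge L e ∉ S → e ∉ sides origin) × (e ∉ sides origin → translateEdge L e ∉ S)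
  new⇔ side-or-ahead =
    (λ τe∉S e∈ → τe∉S (translated-side∈chainSides p d K e∈)) ,
    (λ e∉ τe∈S → e∉ (Sum.[ (λ e∈ → e∈) , (λ ahead → translated-ahead∈chainSides p d K ahead τe∈S) ] side-or-ahead))

module OrderedFieldProperties (F : OrderedField) where

  open OrderedField F public

  commutativeRing : CommutativeRing _ _
  commutativeRing = record { isCommutativeRing = isCommutativeRing }

  open CommutativeRing commutativeRing public
    using (+-assoc; +-comm; +-identityˡ; +-identityʳ; -‿inverseʳ; distribˡ; distribʳ;
           *-identityˡ; *-identityʳ; *-comm; *-assoc; zeroˡ; zeroʳ; ring; +-abelianGroup; +-isCommutativeMonoid)
  open RingProperties ring public using (-‿distribʳ-*; [y-z]x≈yx-zx)
  open AbelianGroupProperties +-abelianGroup public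
    using (∙-cancelʳ; ⁻¹-involutive; \\-leftDividesʳ; //-rightDividesˡ; //-rightDividesʳ; x∙y⁻¹≈ε⇒x≈y)
  open CommutativeSemigroupProperties (CommutativeRing.+-commutativeSemigroup commutativeRing) public
    using (interchange; x∙yz≈y∙xz; x∙yz≈xz∙y; xy∙z≈xz∙y)
  open RawMonoidDefinitions (CommutativeRing.+-rawMonoid commutativeRing) public
    using () renaming (_×_ to infixr 8 _×ᵐ_)
  open CommutativeMonoidMult (CommutativeRing.+-commutativeMonoid commutativeRing) public
    using () renaming (×-distrib-+ to ×ᵐ-distrib-+; ×-homo-+ to ×ᵐ-homo-+)
  open SemiringMult (CommutativeRing.semiring commutativeRing)
    using () renaming (×-assoc-* to ×ᵐ-assoc-*)

  private module ≤ = StrictToNonStrict _≡_ _<_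

  <-resp-≡ : ∀ {x x' y y'} → x ≡ x' → y ≡ y' → x < y → x' < y'
  <-resp-≡ refl refl x<y = x<y

  ≤-trans : ∀ {x y z} → x ≤ y → y ≤ z → x ≤ z
  ≤-trans = ≤.trans isEquivalence ((λ where refl h → h) , (λ where refl h → h)) <-trans

  <-≤-trans : ∀ {x y z} → x < y → y ≤ z → x < z
  <-≤-trans = ≤.<-≤-trans <-trans (λ where refl h → h)

  ≤-<-trans : ∀ {x y z} → x ≤ y → y < z → x < z
  ≤-<-trans = ≤.≤-<-trans sym <-trans (λ where refl h → h)

  <⇒≢ : ∀ {x y} → x < y → x ≢ y
  <⇒≢ x<y refl = <-irrefl _ x<y

  <⇒≱ : ∀ {x y} → x < y → ¬ (y ≤ x)
  <⇒≱ x<y y≤x = <-irrefl _ (<-≤-trans x<y y≤x)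

  +-monoˡ-< : ∀ z {x y} → x < y → x + z < y + z
  +-monoˡ-< z x<y = +-mono-< z x<y

  +-monoʳ-< : ∀ z {x y} → x < y → z + x < z + y
  +-monoʳ-< z {x} {y} x<y = <-resp-≡ (+-comm x z) (+-comm y z) (+-mono-< z x<y)

  +-monoˡ-≤ : ∀ z {x y} → x ≤ y → x + z ≤ y + z
  +-monoˡ-≤ z (inj₁ x<y) = inj₁ (+-monoˡ-< z x<y)
  +-monoˡ-≤ z (inj₂ refl) = inj₂ refl

  +-monoʳ-≤ : ∀ z {x y} → x ≤ y → z + x ≤ z + y
  +-monoʳ-≤ z (inj₁ x<y) = inj₁ (+-monoʳ-< z x<y)
  +-monoʳ-≤ z (inj₂ refl) = inj₂ refl

  +-mono-<-≤ : ∀ {a b c d} → a < b → c ≤ d → a + c < b + d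
  +-mono-<-≤ {b = b} {c = c} a<b c≤d = <-≤-trans (+-monoˡ-< c a<b) (+-monoʳ-≤ b c≤d)

  +-mono-≤-< : ∀ {a b c d} → a ≤ b → c < d → a + c < b + d
  +-mono-≤-< {b = b} {c = c} a≤b c<d = ≤-<-trans (+-monoˡ-≤ c a≤b) (+-monoʳ-< b c<d)

  +-mono-≤ : ∀ {a b c d} → a ≤ b → c ≤ d → a + c ≤ b + d
  +-mono-≤ {b = b} {c = c} a≤b c≤d = ≤-trans (+-monoˡ-≤ c a≤b) (+-monoʳ-≤ b c≤d)

  +-cancelˡ-< : ∀ z {x y} → x + z < y + z → x < y
  +-cancelˡ-< z {x} {y} h = <-resp-≡ (//-rightDividesʳ z x) (//-rightDividesʳ z y) (+-monoˡ-< (- z) h)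

  +-cancelˡ-≤ : ∀ z {x y} → x + z ≤ y + z → x ≤ y
  +-cancelˡ-≤ z (inj₁ h) = inj₁ (+-cancelˡ-< z h)
  +-cancelˡ-≤ z (inj₂ h) = inj₂ (∙-cancelʳ z _ _ h)

  x<y⇒0<y-x : ∀ {x y} → x < y → 0# < y - x
  x<y⇒0<y-x {x} h = <-resp-≡ (-‿inverseʳ x) refl (+-monoˡ-< (- x) h)

  0<y-x⇒x<y : ∀ {x y} → 0# < y - x → x < y
  0<y-x⇒x<y {x} {y} h = <-resp-≡ (+-identityˡ x) (//-rightDividesˡ x y) (+-monoˡ-< x h)

  0<1 : 0# < 1#
  0<1 with <-trichotomy 0# 1#
  ... | inj₁ 0<1 = 0<1
  ... | inj₂ (inj₁ 0≡1) = ⊥-elim (0≢1 0≡1)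
  ... | inj₂ (inj₂ 1<0) = ⊥-elim (<-irrefl 0# (<-trans (<-resp-≡ refl (-1*-1≡1) (*-pos 0<-1 0<-1)) 1<0))
    where
    0<-1 : 0# < - 1#
    0<-1 = <-resp-≡ (-‿inverseʳ 1#) (+-identityˡ (- 1#)) (+-monoˡ-< (- 1#) 1<0)
    -1*-1≡1 : - 1# * - 1# ≡ 1#
    -1*-1≡1 = begin
      - 1# * - 1#   ≡⟨ -‿distribʳ-* (- 1#) 1# ⟨
      - (- 1# * 1#) ≡⟨ cong -_ (*-identityʳ (- 1#)) ⟩
      - - 1#        ≡⟨ ⁻¹-involutive 1# ⟩
      1#            ∎

  *-monoˡ-< : ∀ {c} → 0# < c → ∀ {x y} → x < y → x * c < y * c
  *-monoˡ-< {c} 0<c {x} {y} x<y = 0<y-x⇒x<y (<-resp-≡ refl ([y-z]x≈yx-zx c y x) (*-pos (x<y⇒0<y-x x<y) 0<c))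

  ⁻¹-pos : ∀ {x} → 0# < x → 0# < x ⁻¹
  ⁻¹-pos {x} 0<x with <-trichotomy 0# (x ⁻¹)
  ... | inj₁ 0<x⁻¹ = 0<x⁻¹
  ... | inj₂ (inj₁ 0≡x⁻¹) = ⊥-elim (0≢1 (begin
      0#         ≡⟨ zeroʳ x ⟨
      x * 0#     ≡⟨ cong (x *_) 0≡x⁻¹ ⟩
      x * x ⁻¹   ≡⟨ ⁻¹-inverse x (<⇒≢ 0<x ∘ sym) ⟩
      1#         ∎))
  ... | inj₂ (inj₂ x⁻¹<0) = ⊥-elim (<-irrefl 0# (<-trans (<-resp-≡ refl x*-x⁻¹≡-1 (*-pos 0<x 0<-x⁻¹)) -1<0))
    where
    0<-x⁻¹ : 0# < - x ⁻¹
    0<-x⁻¹ = <-resp-≡ (-‿inverseʳ (x ⁻¹)) (+-identityˡ _) (+-monoˡ-< (- x ⁻¹) x⁻¹<0)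
    x*-x⁻¹≡-1 : x * - x ⁻¹ ≡ - 1#
    x*-x⁻¹≡-1 = trans (sym (-‿distribʳ-* x (x ⁻¹))) (cong -_ (⁻¹-inverse x (<⇒≢ 0<x ∘ sym)))
    -1<0 : - 1# < 0#
    -1<0 = <-resp-≡ (+-identityˡ (- 1#)) (-‿inverseʳ 1#) (+-monoˡ-< (- 1#) 0<1)

  ×ᵐ-monoʳ-≤ : ∀ k {x y} → x ≤ y → k ×ᵐ x ≤ k ×ᵐ y
  ×ᵐ-monoʳ-≤ zero    x≤y = inj₂ refl
  ×ᵐ-monoʳ-≤ (suc k) x≤y = +-mono-≤ x≤y (×ᵐ-monoʳ-≤ k x≤y)

  ×ᵐ-monoʳ-< : ∀ k {x y} → x < y → suc k ×ᵐ x < suc k ×ᵐ y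
  ×ᵐ-monoʳ-< k x<y = +-mono-<-≤ x<y (×ᵐ-monoʳ-≤ k (inj₁ x<y))

  fromℕ≡×ᵐ1# : ∀ k → fromℕ k ≡ k ×ᵐ 1#
  fromℕ≡×ᵐ1# zero    = refl
  fromℕ≡×ᵐ1# (suc k) = cong (1# +_) (fromℕ≡×ᵐ1# k)

  fromℕ-* : ∀ k x → fromℕ k * x ≡ k ×ᵐ x
  fromℕ-* k x = begin
    fromℕ k * x     ≡⟨ cong (_* x) (fromℕ≡×ᵐ1# k) ⟩
    (k ×ᵐ 1#) * x   ≡⟨ ×ᵐ-assoc-* k 1# x ⟩
    k ×ᵐ (1# * x)   ≡⟨ cong (k ×ᵐ_) (*-identityˡ x) ⟩
    k ×ᵐ x          ∎

  fromℕ-+ : ∀ m n → fromℕ (m ℕ.+ n) ≡ fromℕ m + fromℕ n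
  fromℕ-+ m n = begin
    fromℕ (m ℕ.+ n)     ≡⟨ fromℕ≡×ᵐ1# (m ℕ.+ n) ⟩
    (m ℕ.+ n) ×ᵐ 1#     ≡⟨ ×ᵐ-homo-+ 1# m n ⟩
    m ×ᵐ 1# + n ×ᵐ 1#   ≡⟨ cong₂ _+_ (fromℕ≡×ᵐ1# m) (fromℕ≡×ᵐ1# n) ⟨
    fromℕ m + fromℕ n   ∎

  fromℕ-mono-≤ : ∀ {m n} → m ℕ.≤ n → fromℕ m ≤ fromℕ n
  fromℕ-mono-≤ {n = zero}  z≤n = inj₂ refl
  fromℕ-mono-≤ {n = suc n} z≤n = ≤-trans (inj₂ (sym (+-identityˡ 0#))) (+-mono-≤ (inj₁ 0<1) (fromℕ-mono-≤ {n = n} z≤n))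
  fromℕ-mono-≤ (s≤s m≤n) = +-monoʳ-≤ 1# (fromℕ-mono-≤ m≤n)

  fromℕ-mono-< : ∀ {m n} → m ℕ.< n → fromℕ m < fromℕ n
  fromℕ-mono-< {m} (s≤s m≤n) = <-≤-trans (<-resp-≡ (+-identityˡ (fromℕ m)) refl (+-monoˡ-< (fromℕ m) 0<1))
                                          (+-monoʳ-≤ 1# (fromℕ-mono-≤ m≤n))

  fromℕ-cancel-< : ∀ {m n} → fromℕ m < fromℕ n → m ℕ.< n
  fromℕ-cancel-< {m} {n} m<n with n ℕ.≤? m
  ... | yes n≤m = ⊥-elim (<⇒≱ m<n (fromℕ-mono-≤ n≤m))
  ... | no  n≰m = ℕ.≰⇒> n≰m

  fromℕ-3+ : ∀ k → fromℕ (3 ℕ.+ k) ≡ fromℕ k + fromℕ 3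
  fromℕ-3+ k = trans (fromℕ-+ 3 k) (+-comm (fromℕ 3) (fromℕ k))

  below-ceiling : ∀ {y m n} → IsCeiling F y m → n ℕ.< m → fromℕ n < y
  below-ceiling {n = n} (m-1<y , _) n<m = ≤-<-trans (≤-trans (inj₂ n≡1+n-1) (+-monoˡ-≤ (- 1#) (fromℕ-mono-≤ n<m))) m-1<y
    where
    n≡1+n-1 : fromℕ n ≡ fromℕ (suc n) - 1#
    n≡1+n-1 = trans (sym (//-rightDividesʳ 1# (fromℕ n))) (cong (_- 1#) (+-comm (fromℕ n) 1#))

  above-ceiling : ∀ {y m n} → IsCeiling F y m → m ℕ.< n → y < fromℕ n
  above-ceiling (_ , y≤m) m<n = ≤-<-trans y≤m (fromℕ-mono-< m<n)

  x*½<y⇒x<y+y : ∀ {x y} → x * (1# + 1#) ⁻¹ < y → x < y + y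
  x*½<y⇒x<y+y {x} {y} h = <-resp-≡ x*½*2≡x y*2≡y+y (*-monoˡ-< 0<2 h)
    where
    0<2 : 0# < 1# + 1#
    0<2 = <-resp-≡ (+-identityˡ 0#) refl (+-mono-<-≤ 0<1 (inj₁ 0<1))
    x*½*2≡x : x * (1# + 1#) ⁻¹ * (1# + 1#) ≡ x
    x*½*2≡x = begin
      x * (1# + 1#) ⁻¹ * (1# + 1#)    ≡⟨ *-assoc x _ _ ⟩
      x * ((1# + 1#) ⁻¹ * (1# + 1#))  ≡⟨ cong (x *_) (*-comm _ _) ⟩
      x * ((1# + 1#) * (1# + 1#) ⁻¹)  ≡⟨ cong (x *_) (⁻¹-inverse _ (<⇒≢ 0<2 ∘ sym)) ⟩
      x * 1#                          ≡⟨ *-identityʳ x ⟩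
      x                               ∎
    y*2≡y+y : y * (1# + 1#) ≡ y + y
    y*2≡y+y = trans (distribˡ y 1# 1#) (cong₂ _+_ (*-identityʳ y) (*-identityʳ y))

DegreePair : Set
DegreePair = ℕ × ℕ

_≟DP_ : DecidableEquality (List DegreePair)
_≟DP_ = List.≡-dec (Product.≡-dec ℕ._≟_ ℕ._≟_)

infixl 6 _⊕_ _⊖_
infixr 7 _·_

-- Integer combinations of values f(i, j). Two such sums are equal as soon as their canonical
-- multisets of degree pairs agree (canonical⇒Σf≡Σf+⟦⟧), which evaluation can decide.
data Expr : Set where
  f⟨_,_⟩  : ℕ → ℕ → Expr
  _·_     : ℕ → Expr → Expr
  _⊕_ _⊖_ : Expr → Expr → Expr
  ∅       : Expr

positive negative : Expr → List DegreePair
positive f⟨ i , j ⟩ = (i , j) ∷ []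
positive (k · e)    = concat (List.replicate k (positive e))
positive (a ⊕ b)    = positive a ++ positive b
positive (a ⊖ b)    = positive a ++ negative b
positive ∅          = []
negative f⟨ i , j ⟩ = []
negative (k · e)    = concat (List.replicate k (negative e))
negative (a ⊕ b)    = negative a ++ negative b
negative (a ⊖ b)    = negative a ++ positive b
negative ∅          = []

orient : DegreePair → DegreePair
orient (a , b) = if a ≤ᵇ b then (a , b) else (b , a)

canonical : List DegreePair → List DegreePair
canonical ps = sort (map orient ps)

module FormalSums (F : OrderedField) (f : ℕ → ℕ → OrderedField.Carrier F) where

  open OrderedFieldProperties F

  ⟦_⟧ : Expr → Carrier
  ⟦ f⟨ i , j ⟩ ⟧ = f i j
  ⟦ k · e ⟧      = fromℕ k * ⟦ e ⟧
  ⟦ a ⊕ b ⟧      = ⟦ a ⟧ + ⟦ b ⟧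
  ⟦ a ⊖ b ⟧      = ⟦ a ⟧ - ⟦ b ⟧
  ⟦ ∅ ⟧          = 0#

  Σf : List DegreePair → Carrier
  Σf ps = foldr _+_ 0# (map (uncurry f) ps)

  Σf-++ : ∀ ps qs → Σf (ps ++ qs) ≡ Σf ps + Σf qs
  Σf-++ []       qs = sym (+-identityˡ _)
  Σf-++ (p ∷ ps) qs = trans (cong (uncurry f p +_) (Σf-++ ps qs)) (sym (+-assoc _ _ _))

  Σf-replicate : ∀ k ps → Σf (concat (List.replicate k ps)) ≡ fromℕ k * Σf ps
  Σf-replicate zero    ps = sym (zeroˡ _)
  Σf-replicate (suc k) ps = begin
    Σf (ps ++ concat (List.replicate k ps))    ≡⟨ Σf-++ ps _ ⟩
    Σf ps + Σf (concat (List.replicate k ps))  ≡⟨ cong₂ _+_ (sym (*-identityˡ _)) (Σf-replicate k ps) ⟩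
    1# * Σf ps + fromℕ k * Σf ps               ≡⟨ distribʳ (Σf ps) 1# (fromℕ k) ⟨
    fromℕ (suc k) * Σf ps                      ∎

  ⟦⟧+negative : ∀ e → ⟦ e ⟧ + Σf (negative e) ≡ Σf (positive e)
  ⟦⟧+negative f⟨ i , j ⟩ = refl
  ⟦⟧+negative (k · e) = begin
    fromℕ k * ⟦ e ⟧ + Σf (concat (List.replicate k (negative e)))  ≡⟨ cong (fromℕ k * ⟦ e ⟧ +_) (Σf-replicate k _) ⟩
    fromℕ k * ⟦ e ⟧ + fromℕ k * Σf (negative e)                    ≡⟨ distribˡ (fromℕ k) _ _ ⟨
    fromℕ k * (⟦ e ⟧ + Σf (negative e))                            ≡⟨ cong (fromℕ k *_) (⟦⟧+negative e) ⟩
    fromℕ k * Σf (positive e)                                      ≡⟨ Σf-replicate k _ ⟨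
    Σf (concat (List.replicate k (positive e)))                    ∎
  ⟦⟧+negative (a ⊕ b) = begin
    (⟦ a ⟧ + ⟦ b ⟧) + Σf (negative a ++ negative b)           ≡⟨ cong ((⟦ a ⟧ + ⟦ b ⟧) +_) (Σf-++ (negative a) _) ⟩
    (⟦ a ⟧ + ⟦ b ⟧) + (Σf (negative a) + Σf (negative b))     ≡⟨ interchange _ _ _ _ ⟩
    (⟦ a ⟧ + Σf (negative a)) + (⟦ b ⟧ + Σf (negative b))     ≡⟨ cong₂ _+_ (⟦⟧+negative a) (⟦⟧+negative b) ⟩
    Σf (positive a) + Σf (positive b)                         ≡⟨ Σf-++ (positive a) _ ⟨
    Σf (positive a ++ positive b)                             ∎
  ⟦⟧+negative (a ⊖ b) = begin
    (⟦ a ⟧ - ⟦ b ⟧) + Σf (negative a ++ positive b)           ≡⟨ cong ((⟦ a ⟧ - ⟦ b ⟧) +_) (Σf-++ (negative a) _) ⟩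
    (⟦ a ⟧ - ⟦ b ⟧) + (Σf (negative a) + Σf (positive b))     ≡⟨ interchange _ _ _ _ ⟩
    (⟦ a ⟧ + Σf (negative a)) + (- ⟦ b ⟧ + Σf (positive b))   ≡⟨ cong₂ _+_ (⟦⟧+negative a) (cong (- ⟦ b ⟧ +_) (sym (⟦⟧+negative b))) ⟩
    Σf (positive a) + (- ⟦ b ⟧ + (⟦ b ⟧ + Σf (negative b)))   ≡⟨ cong (Σf (positive a) +_) (\\-leftDividesʳ ⟦ b ⟧ _) ⟩
    Σf (positive a) + Σf (negative b)                         ≡⟨ Σf-++ (positive a) _ ⟨
    Σf (positive a ++ negative b)                             ∎
  ⟦⟧+negative ∅ = +-identityˡ 0#

  Σf-↭ : ∀ {ps qs} → ps ↭ qs → Σf ps ≡ Σf qs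
  Σf-↭ ps↭qs = PermSetoid.foldr-commMonoid (setoid Carrier) +-isCommutativeMonoid (↭⇒↭ₛ (Perm.map⁺ (uncurry f) ps↭qs))

  Σf-canonical : (∀ a b → f a b ≡ f b a) → ∀ ps → Σf (canonical ps) ≡ Σf ps
  Σf-canonical f-sym ps = trans (Σf-↭ (sort-↭ (map orient ps))) (Σf-orient ps)
    where
    Σf-orient : ∀ ps → Σf (map orient ps) ≡ Σf ps
    Σf-orient []             = refl
    Σf-orient ((a , b) ∷ ps) = cong₂ _+_ (f-orient (a ≤ᵇ b)) (Σf-orient ps)
      where
      f-orient : ∀ c → uncurry f (if c then (a , b) else (b , a)) ≡ f a b
      f-orient true  = refl
      f-orient false = f-sym b a

  canonical⇒Σf≡Σf+⟦⟧ : (∀ a b → f a b ≡ f b a) → ∀ ps qs e →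
    canonical (ps ++ negative e) ≡ canonical (qs ++ positive e) → Σf ps ≡ Σf qs + ⟦ e ⟧
  canonical⇒Σf≡Σf+⟦⟧ f-sym ps qs e eq = ∙-cancelʳ (Σf (negative e)) _ _ (begin
    Σf ps + Σf (negative e)                 ≡⟨ Σf-++ ps _ ⟨
    Σf (ps ++ negative e)                   ≡⟨ Σf-canonical f-sym (ps ++ negative e) ⟨
    Σf (canonical (ps ++ negative e))       ≡⟨ cong Σf eq ⟩
    Σf (canonical (qs ++ positive e))       ≡⟨ Σf-canonical f-sym (qs ++ positive e) ⟩
    Σf (qs ++ positive e)                   ≡⟨ Σf-++ qs _ ⟩
    Σf qs + Σf (positive e)                 ≡⟨ cong (Σf qs +_) (⟦⟧+negative e) ⟨
    Σf qs + (⟦ e ⟧ + Σf (negative e))       ≡⟨ +-assoc _ _ _ ⟨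
    (Σf qs + ⟦ e ⟧) + Σf (negative e)       ∎)

-- ⟦ linkPairExpr a b ⟧ and ⟦ firstLinkExpr L2 ⟧ reduce to the g11, g12, g21, g22 and g2 of Defs;
-- cornerExpr is the constant c of the transfer formula.
cornerExpr : Expr
cornerExpr = 2 · f⟨ 2 , 2 ⟩ ⊕ 4 · f⟨ 2 , 3 ⟩ ⊕ f⟨ 3 , 3 ⟩

firstLinkExpr : Link → Expr
firstLinkExpr L1 = 3 · f⟨ 3 , 3 ⟩
firstLinkExpr L2 = 2 · f⟨ 3 , 4 ⟩ ⊕ 2 · f⟨ 2 , 4 ⟩ ⊖ f⟨ 3 , 3 ⟩

linkPairExpr : Link → Link → Expr
linkPairExpr L1 L1 = 3 · f⟨ 3 , 3 ⟩
linkPairExpr L1 L2 = 3 · f⟨ 3 , 4 ⟩ ⊕ f⟨ 2 , 4 ⟩ ⊕ f⟨ 2 , 3 ⟩ ⊖ 2 · f⟨ 3 , 3 ⟩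
linkPairExpr L2 L1 = f⟨ 3 , 4 ⟩ ⊖ f⟨ 2 , 4 ⟩ ⊕ f⟨ 2 , 3 ⟩ ⊕ 2 · f⟨ 3 , 3 ⟩
linkPairExpr L2 L2 = f⟨ 4 , 4 ⟩ ⊕ 2 · f⟨ 2 , 4 ⟩

linksExpr : Link → List Link → Expr
linksExpr a []      = ∅
linksExpr a (b ∷ r) = linkPairExpr a b ⊕ linksExpr b r

chainExpr : Link → List Link → Expr
chainExpr a r = cornerExpr ⊕ firstLinkExpr a ⊕ linksExpr a r

degreePair : (Point → ℕ) → Edge → DegreePair
degreePair δ (u , w) = (δ u , δ w)

degreePairsIn : List Edge → List Edge → List DegreePair
degreePairsIn X es = map (degreePair (degreeIn X)) es

SomeDiagAtMost : ℤ → Edge → Set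
SomeDiagAtMost k (u , w) = diag u ℤ.≤ k ⊎ diag w ℤ.≤ k

DiagAtLeast : ℤ → Edge → Set
DiagAtLeast k (u , w) = k ℤ.≤ diag u × k ℤ.≤ diag w

diagAtMost? : ∀ k → Decidable (DiagAtMost k)
diagAtMost? k (u , w) = (diag u ℤ.≤? k) ×-dec (diag w ℤ.≤? k)

someDiagAtMost? : ∀ k → Decidable (SomeDiagAtMost k)
someDiagAtMost? k (u , w) = (diag u ℤ.≤? k) ⊎-dec (diag w ℤ.≤? k)

diagAtLeast? : ∀ k → Decidable (DiagAtLeast k)
diagAtLeast? k (u , w) = (k ℤ.≤? diag u) ×-dec (k ℤ.≤? diag w)

windowAhead? : ∀ d W → Dec (WindowAhead d W)
windowAhead? d W = all? (λ e → (e ∈? sides origin) ⊎-dec ahead? e) (windowSides d W)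
  where
  ahead? : Decidable Ahead
  ahead? (u , w) = (1ℤ ℤ.≤? diag u) ⊎-dec (1ℤ ℤ.≤? diag w)

near? : Decidable (DiagAtMost (ℤ.+ 2))
near? = diagAtMost? (ℤ.+ 2)

near touching far : List Edge → List Edge
near     = filter near?
touching = filter (someDiagAtMost? (ℤ.+ 2))
far      = filter (∁? near?)

-- The window of the last three links a₁ a₂ a₃ and a new link b, relative to the last square of
-- the prefix (moved to the origin). Facts holds for all 2 × 2⁴ windows by evaluation, and is
-- what makes appending b add exactly g_f(a₃, b).
module Window (d : Dir) (a₁ a₂ a₃ b : Link) where

  W₃ W₄ : List Link
  W₃ = a₁ ∷ a₂ ∷ a₃ ∷ []
  W₄ = a₁ ∷ a₂ ∷ a₃ ∷ b ∷ []

  X₃ X₄ : List Edge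
  X₃ = windowEdges d W₃
  X₄ = windowEdges d W₄

  record Facts : Set where
    field
      ahead₃        : WindowAhead d W₃
      ahead₄        : WindowAhead d W₄
      near-same     : near X₄ ≡ near X₃
      touching-same : touching X₄ ≡ touching X₃
      far₃          : All (DiagAtLeast (ℤ.+ 2)) (far X₃)
      far₄          : All (DiagAtLeast (ℤ.+ 2)) (far X₄)
      far-sum       : canonical (degreePairsIn X₄ (far X₄) ++ negative (linkPairExpr a₃ b))
                    ≡ canonical (degreePairsIn X₃ (far X₃) ++ positive (linkPairExpr a₃ b))

  facts? : Dec Facts
  facts? = map′ (λ (p₁ , p₂ , p₃ , p₄ , p₅ , p₆ , p₇) → record
                   { ahead₃ = p₁ ; ahead₄ = p₂ ; near-same = p₃ ; touching-same = p₄ ; far₃ = p₅ ; far₄ = p₆ ; far-sum = p₇ })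
                (λ fs → let open Facts fs in ahead₃ , ahead₄ , near-same , touching-same , far₃ , far₄ , far-sum)
                (windowAhead? d W₃ ×-dec windowAhead? d W₄ ×-dec
                 List.≡-dec _≟E_ (near X₄) (near X₃) ×-dec
                 List.≡-dec _≟E_ (touching X₄) (touching X₃) ×-dec
                 all? (diagAtLeast? (ℤ.+ 2)) (far X₃) ×-dec all? (diagAtLeast? (ℤ.+ 2)) (far X₄) ×-dec
                 (canonical (degreePairsIn X₄ (far X₄) ++ negative (linkPairExpr a₃ b))
                   ≟DP canonical (degreePairsIn X₃ (far X₃) ++ positive (linkPairExpr a₃ b))))

windowChecks : ∀ d a₁ a₂ a₃ b → True (Window.facts? d a₁ a₂ a₃ b)
windowChecks right L1 L1 L1 L1 = _
windowChecks right L1 L1 L1 L2 = _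
windowChecks right L1 L1 L2 L1 = _
windowChecks right L1 L1 L2 L2 = _
windowChecks right L1 L2 L1 L1 = _
windowChecks right L1 L2 L1 L2 = _
windowChecks right L1 L2 L2 L1 = _
windowChecks right L1 L2 L2 L2 = _
windowChecks right L2 L1 L1 L1 = _
windowChecks right L2 L1 L1 L2 = _
windowChecks right L2 L1 L2 L1 = _
windowChecks right L2 L1 L2 L2 = _
windowChecks right L2 L2 L1 L1 = _
windowChecks right L2 L2 L1 L2 = _
windowChecks right L2 L2 L2 L1 = _
windowChecks right L2 L2 L2 L2 = _
windowChecks down  L1 L1 L1 L1 = _
windowChecks down  L1 L1 L1 L2 = _
windowChecks down  L1 L1 L2 L1 = _
windowChecks down  L1 L1 L2 L2 = _
windowChecks down  L1 L2 L1 L1 = _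
windowChecks down  L1 L2 L1 L2 = _
windowChecks down  L1 L2 L2 L1 = _
windowChecks down  L1 L2 L2 L2 = _
windowChecks down  L2 L1 L1 L1 = _
windowChecks down  L2 L1 L1 L2 = _
windowChecks down  L2 L1 L2 L1 = _
windowChecks down  L2 L1 L2 L2 = _
windowChecks down  L2 L2 L1 L1 = _
windowChecks down  L2 L2 L1 L2 = _
windowChecks down  L2 L2 L2 L1 = _
windowChecks down  L2 L2 L2 L2 = _

ShortChainCheck : Link → List Link → Set
ShortChainCheck a r =
  True (canonical (degreePairsIn (edges (a ∷ r)) (edges (a ∷ r)) ++ negative (chainExpr a r)) ≟DP canonical (positive (chainExpr a r)))

shortChainChecks₁ : ∀ a → ShortChainCheck a []
shortChainChecks₁ L1 = _
shortChainChecks₁ L2 = _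

shortChainChecks₂ : ∀ a b → ShortChainCheck a (b ∷ [])
shortChainChecks₂ L1 L1 = _
shortChainChecks₂ L1 L2 = _
shortChainChecks₂ L2 L1 = _
shortChainChecks₂ L2 L2 = _

-- The transfer formula

module TIFormula (F : OrderedField) (f : ℕ → ℕ → OrderedField.Carrier F) (f-sym : ∀ a b → f a b ≡ f b a) where

  open OrderedFieldProperties F
  open FormalSums F f

  edgeSum : (Point → ℕ) → List Edge → Carrier
  edgeSum δ es = Σf (map (degreePair δ) es)

  TI≡edgeSum : ∀ ls → TI F f ls ≡ edgeSum (degree ls) (edges ls)
  TI≡edgeSum ls = cong (foldr _+_ 0#) (List.map-∘ (edges ls))

  edgeSum-++ : ∀ δ es es' → edgeSum δ (es ++ es') ≡ edgeSum δ es + edgeSum δ es'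
  edgeSum-++ δ es es' = trans (cong Σf (List.map-++ (degreePair δ) es es')) (Σf-++ (map (degreePair δ) es) _)

  edgeSum-local : ∀ {δ δ'} {es} → All (λ e → degreePair δ e ≡ degreePair δ' e) es → edgeSum δ es ≡ edgeSum δ' es
  edgeSum-local same = cong Σf (List.map-cong-local same)

  edgeSum-translate : ∀ δ p es → edgeSum δ (map (translateEdge p) es) ≡ edgeSum (δ ∘ translate p) es
  edgeSum-translate δ p es = cong Σf (sym (List.map-∘ es))

  edgeSum-partition : ∀ {P : Pred Edge 0ℓ} (P? : Decidable P) δ es →
                      edgeSum δ es ≡ edgeSum δ (filter P? es) + edgeSum δ (filter (∁? P?) es)
  edgeSum-partition P? δ es = begin
    edgeSum δ es                                              ≡⟨ Σf-↭ (Perm.map⁺ (degreePair δ) es↭) ⟩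
    edgeSum δ (filter P? es ++ filter (∁? P?) es)             ≡⟨ edgeSum-++ δ (filter P? es) _ ⟩
    edgeSum δ (filter P? es) + edgeSum δ (filter (∁? P?) es)  ∎
    where
    es↭ : es ↭ filter P? es ++ filter (∁? P?) es
    es↭ = subst (λ (ys , zs) → es ↭ ys ++ zs) (List.partition-defn P? es)
                (↭ₛ⇒↭ (PermSetoid.partition-↭ (setoid Edge) P? es))

  chainTI : List Link → Carrier
  chainTI K = edgeSum (degreeIn (chainEdges origin right K)) (chainEdges origin right K)

  -- S₂ is the square that a link L1 adds to S₁ = origin in direction right.
  TI≡chainTI : ∀ ls → TI F f ls ≡ chainTI (L1 ∷ ls)
  TI≡chainTI ls = TI≡edgeSum ls

  module Prefix (pre : List Link) where

    L : Point
    L = lastSquare origin right pre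

    E : List Edge
    E = chainEdges origin right pre

    degreeWith : List Edge → Point → ℕ
    degreeWith X = degreeIn (E ++ map (translateEdge L) X)

    prefixPart nearPart farPart : List Edge → Carrier
    prefixPart X = edgeSum (degreeWith X) E
    nearPart   X = edgeSum (degreeWith X ∘ translate L) (near X)
    farPart    X = edgeSum (degreeWith X ∘ translate L) (far X)

    chainTI-window : ∀ W → WindowAhead (lastDir right pre) W → let X = windowEdges (lastDir right pre) W in
                     chainTI (pre ++ W) ≡ prefixPart X + (nearPart X + farPart X)
    chainTI-window W ahead = begin
      chainTI (pre ++ W)
        ≡⟨ cong (λ es → edgeSum (degreeIn es) es) (chainEdges-++ origin right pre W ahead) ⟩
      edgeSum (degreeWith X) (E ++ map (translateEdge L) X)
        ≡⟨ edgeSum-++ (degreeWith X) E _ ⟩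
      prefixPart X + edgeSum (degreeWith X) (map (translateEdge L) X)
        ≡⟨ cong (prefixPart X +_) (edgeSum-translate (degreeWith X) L X) ⟩
      prefixPart X + edgeSum (degreeWith X ∘ translate L) X
        ≡⟨ cong (prefixPart X +_) (edgeSum-partition near? (degreeWith X ∘ translate L) X) ⟩
      prefixPart X + (nearPart X + farPart X) ∎
      where X = windowEdges (lastDir right pre) W

    -- Relative to L the prefix lies on diagonals ≤ 1, so from diagonal 2 on only the window contributes.
    degreeWith-far : ∀ X u → ℤ.+ 2 ℤ.≤ diag u → degreeWith X (translate L u) ≡ degreeIn X u
    degreeWith-far X u 2≤u = begin
      degreeWith X (translate L u)
        ≡⟨ degreeIn-++ E _ (translate L u) ⟩
      degreeIn E (translate L u) ℕ.+ degreeIn (map (translateEdge L) X) (translate L u)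
        ≡⟨ cong₂ ℕ._+_ (degreeIn-none (All.map not-incident (chainEdges-diagAtMost origin right pre)))
                       (degreeIn-translate L X u) ⟩
      degreeIn X u ∎
      where
      beyond : ℤ.suc (diag L) ℤ.< diag (translate L u)
      beyond = ℤ.suc[i]≤j⇒i<j (ℤ.≤-trans (ℤ.≤-reflexive (two+ (diag L)))
                 (ℤ.≤-trans (ℤ.+-monoˡ-≤ (diag L) 2≤u) (ℤ.≤-reflexive (sym (diag-translate L u)))))
        where two+ : ∀ i → 1ℤ ℤ.+ (1ℤ ℤ.+ i) ≡ ℤ.+ 2 ℤ.+ i
              two+ = solve-∀
      not-incident : ∀ {e} → DiagAtMost (ℤ.suc (diag L)) e → ¬ Incident (translate L u) e
      not-incident (v≤ , w≤) (inj₁ refl) = ℤ.<⇒≱ beyond v≤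
      not-incident (v≤ , w≤) (inj₂ refl) = ℤ.<⇒≱ beyond w≤

    sameDegree-near : ∀ {X X'} → touching X ≡ touching X' →
                      ∀ u → diag u ℤ.≤ ℤ.+ 2 → degreeWith X (translate L u) ≡ degreeWith X' (translate L u)
    sameDegree-near {X} {X'} same-touching u u≤2 = begin
      degreeWith X (translate L u)
        ≡⟨ degreeIn-++ E _ (translate L u) ⟩
      degreeIn E (translate L u) ℕ.+ degreeIn (map (translateEdge L) X) (translate L u)
        ≡⟨ cong (degreeIn E (translate L u) ℕ.+_) window-same ⟩
      degreeIn E (translate L u) ℕ.+ degreeIn (map (translateEdge L) X') (translate L u)
        ≡⟨ degreeIn-++ E _ (translate L u) ⟨
      degreeWith X' (translate L u) ∎
      where
      touches : ∀ {e} → Incident u e → SomeDiagAtMost (ℤ.+ 2) e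
      touches (inj₁ refl) = inj₁ u≤2
      touches (inj₂ refl) = inj₂ u≤2
      window-same : degreeIn (map (translateEdge L) X) (translate L u) ≡ degreeIn (map (translateEdge L) X') (translate L u)
      window-same = begin
        degreeIn (map (translateEdge L) X) (translate L u)   ≡⟨ degreeIn-translate L X u ⟩
        degreeIn X u                                         ≡⟨ degreeIn-filter (someDiagAtMost? (ℤ.+ 2)) X u touches ⟨
        degreeIn (touching X) u                              ≡⟨ cong (λ Y → degreeIn Y u) same-touching ⟩
        degreeIn (touching X') u                             ≡⟨ degreeIn-filter (someDiagAtMost? (ℤ.+ 2)) X' u touches ⟩
        degreeIn X' u                                        ≡⟨ degreeIn-translate L X' u ⟨
        degreeIn (map (translateEdge L) X') (translate L u)  ∎

    sameDegree-prefix : ∀ {X X'} → touching X ≡ touching X' →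
                        ∀ v → diag v ℤ.≤ ℤ.suc (diag L) → degreeWith X v ≡ degreeWith X' v
    sameDegree-prefix {X} {X'} same-touching v v≤ =
      subst (λ w → degreeWith X w ≡ degreeWith X' w) (translate-untranslate L v) (sameDegree-near same-touching u u≤2)
      where
      u = untranslate L v
      u+L≤2+L : diag u ℤ.+ diag L ℤ.≤ ℤ.+ 2 ℤ.+ diag L
      u+L≤2+L = ℤ.≤-trans (ℤ.≤-reflexive (trans (sym (diag-translate L u)) (cong diag (translate-untranslate L v))))
                          (ℤ.≤-trans v≤ (ℤ.+-monoˡ-≤ (diag L) (ℤ.+≤+ (ℕ.s≤s ℕ.z≤n))))
      u≤2 : diag u ℤ.≤ ℤ.+ 2
      u≤2 = +-cancelʳ-≤ (diag L) u+L≤2+L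

    prefixPart-same : ∀ {X X'} → touching X ≡ touching X' → prefixPart X ≡ prefixPart X'
    prefixPart-same same-touching = edgeSum-local
      (All.map (λ {e} (u≤ , w≤) → cong₂ _,_ (same (proj₁ e) u≤) (same (proj₂ e) w≤)) (chainEdges-diagAtMost origin right pre))
      where same = sameDegree-prefix same-touching

    nearPart-same : ∀ {X X'} → touching X ≡ touching X' → near X ≡ near X' → nearPart X ≡ nearPart X'
    nearPart-same {X} {X'} same-touching same-near = trans
      (edgeSum-local (All.map (λ {e} (u≤ , w≤) → cong₂ _,_ (same (proj₁ e) u≤) (same (proj₂ e) w≤)) (All.all-filter near? X)))
      (cong (edgeSum (degreeWith X' ∘ translate L)) same-near)
      where same = sameDegree-near same-touching

    farPart≡ : ∀ X → All (DiagAtLeast (ℤ.+ 2)) (far X) → farPart X ≡ edgeSum (degreeIn X) (far X)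
    farPart≡ X all-far = edgeSum-local
      (All.map (λ {e} (u≥ , w≥) → cong₂ _,_ (degreeWith-far X (proj₁ e) u≥) (degreeWith-far X (proj₂ e) w≥)) all-far)

    chainTI-step : ∀ a₁ a₂ a₃ b →
      chainTI (pre ++ a₁ ∷ a₂ ∷ a₃ ∷ b ∷ []) ≡ chainTI (pre ++ a₁ ∷ a₂ ∷ a₃ ∷ []) + ⟦ linkPairExpr a₃ b ⟧
    chainTI-step a₁ a₂ a₃ b = begin
      chainTI (pre ++ W₄)
        ≡⟨ chainTI-window W₄ ahead₄ ⟩
      prefixPart X₄ + (nearPart X₄ + farPart X₄)
        ≡⟨ cong₂ _+_ (prefixPart-same {X₄} {X₃} touching-same) (cong₂ _+_ (nearPart-same {X₄} {X₃} touching-same near-same) far-change) ⟩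
      prefixPart X₃ + (nearPart X₃ + (farPart X₃ + g))
        ≡⟨ cong (prefixPart X₃ +_) (+-assoc (nearPart X₃) _ g) ⟨
      prefixPart X₃ + ((nearPart X₃ + farPart X₃) + g)
        ≡⟨ +-assoc (prefixPart X₃) _ g ⟨
      (prefixPart X₃ + (nearPart X₃ + farPart X₃)) + g
        ≡⟨ cong (_+ g) (chainTI-window W₃ ahead₃) ⟨
      chainTI (pre ++ W₃) + g ∎
      where
      open Window (lastDir right pre) a₁ a₂ a₃ b
      open Facts (toWitness (windowChecks (lastDir right pre) a₁ a₂ a₃ b))
      g = ⟦ linkPairExpr a₃ b ⟧
      far-change : farPart X₄ ≡ farPart X₃ + g
      far-change = begin
        farPart X₄                              ≡⟨ farPart≡ X₄ far₄ ⟩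
        edgeSum (degreeIn X₄) (far X₄)          ≡⟨ canonical⇒Σf≡Σf+⟦⟧ f-sym (degreePairsIn X₄ (far X₄)) (degreePairsIn X₃ (far X₃)) (linkPairExpr a₃ b) far-sum ⟩
        edgeSum (degreeIn X₃) (far X₃) + g      ≡⟨ cong (_+ g) (farPart≡ X₃ far₃) ⟨
        farPart X₃ + g                          ∎

  chainTI-extend : ∀ pre a₁ a₂ a₃ s →
    chainTI (pre ++ a₁ ∷ a₂ ∷ a₃ ∷ s) ≡ chainTI (pre ++ a₁ ∷ a₂ ∷ a₃ ∷ []) + ⟦ linksExpr a₃ s ⟧
  chainTI-extend pre a₁ a₂ a₃ []      = sym (+-identityʳ _)
  chainTI-extend pre a₁ a₂ a₃ (b ∷ s) = begin
    chainTI (pre ++ a₁ ∷ a₂ ∷ a₃ ∷ b ∷ s)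
      ≡⟨ cong chainTI (List.++-assoc pre (a₁ ∷ []) _) ⟨
    chainTI ((pre ++ a₁ ∷ []) ++ a₂ ∷ a₃ ∷ b ∷ s)
      ≡⟨ chainTI-extend (pre ++ a₁ ∷ []) a₂ a₃ b s ⟩
    chainTI ((pre ++ a₁ ∷ []) ++ a₂ ∷ a₃ ∷ b ∷ []) + ⟦ linksExpr b s ⟧
      ≡⟨ cong (λ K → chainTI K + ⟦ linksExpr b s ⟧) (List.++-assoc pre (a₁ ∷ []) _) ⟩
    chainTI (pre ++ a₁ ∷ a₂ ∷ a₃ ∷ b ∷ []) + ⟦ linksExpr b s ⟧
      ≡⟨ cong (_+ ⟦ linksExpr b s ⟧) (Prefix.chainTI-step pre a₁ a₂ a₃ b) ⟩
    (chainTI (pre ++ a₁ ∷ a₂ ∷ a₃ ∷ []) + ⟦ linkPairExpr a₃ b ⟧) + ⟦ linksExpr b s ⟧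
      ≡⟨ +-assoc _ _ _ ⟩
    chainTI (pre ++ a₁ ∷ a₂ ∷ a₃ ∷ []) + ⟦ linksExpr a₃ (b ∷ s) ⟧ ∎

  TI-short : ∀ a r → ShortChainCheck a r → TI F f (a ∷ r) ≡ ⟦ chainExpr a r ⟧
  TI-short a r check = begin
    TI F f (a ∷ r)
      ≡⟨ TI≡edgeSum (a ∷ r) ⟩
    edgeSum (degree (a ∷ r)) (edges (a ∷ r))
      ≡⟨ canonical⇒Σf≡Σf+⟦⟧ f-sym (degreePairsIn (edges (a ∷ r)) (edges (a ∷ r))) [] (chainExpr a r) (toWitness check) ⟩
    0# + ⟦ chainExpr a r ⟧
      ≡⟨ +-identityˡ _ ⟩
    ⟦ chainExpr a r ⟧ ∎

  TI-formula : ∀ a r → TI F f (a ∷ r) ≡ ⟦ chainExpr a r ⟧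
  TI-formula a []          = TI-short a [] (shortChainChecks₁ a)
  TI-formula a (b ∷ [])    = TI-short a (b ∷ []) (shortChainChecks₂ a b)
  TI-formula a (b ∷ c ∷ s) = begin
    TI F f (a ∷ b ∷ c ∷ s)
      ≡⟨ TI≡chainTI (a ∷ b ∷ c ∷ s) ⟩
    chainTI ([] ++ L1 ∷ a ∷ b ∷ c ∷ s)
      ≡⟨ chainTI-extend [] L1 a b (c ∷ s) ⟩
    chainTI (L1 ∷ a ∷ b ∷ []) + ⟦ linksExpr b (c ∷ s) ⟧
      ≡⟨ cong (_+ ⟦ linksExpr b (c ∷ s) ⟧) (trans (sym (TI≡chainTI (a ∷ b ∷ []))) (TI-formula a (b ∷ []))) ⟩
    (⟦ cornerExpr ⊕ firstLinkExpr a ⟧ + (⟦ linkPairExpr a b ⟧ + 0#)) + ⟦ linksExpr b (c ∷ s) ⟧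
      ≡⟨ cong (λ x → (⟦ cornerExpr ⊕ firstLinkExpr a ⟧ + x) + ⟦ linksExpr b (c ∷ s) ⟧) (+-identityʳ _) ⟩
    (⟦ cornerExpr ⊕ firstLinkExpr a ⟧ + ⟦ linkPairExpr a b ⟧) + ⟦ linksExpr b (c ∷ s) ⟧
      ≡⟨ +-assoc _ _ _ ⟩
    ⟦ chainExpr a (b ∷ c ∷ s) ⟧ ∎

-- Maximisers

module Extremal (F : OrderedField) (f : ℕ → ℕ → OrderedField.Carrier F) (f-sym : ∀ a b → f a b ≡ f b a) where

  open OrderedFieldProperties F
  open FormalSums F f
  open TIFormula F f f-sym

  g₁₁ g₁₂ g₂₁ g₂₂ g₂ c : Carrier
  g₁₁ = g11 F f
  g₁₂ = g12 F f
  g₂₁ = g21 F f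
  g₂₂ = g22 F f
  g₂  = g2 F f
  c   = ⟦ cornerExpr ⟧

  TIᵛ : ∀ {m} → Vec Link m → Carrier
  TIᵛ v = TI F f (toList v)

  linkSum : Link → List Link → Carrier
  linkSum a r = ⟦ linksExpr a r ⟧

  linkSum-replicate : ∀ k a → linkSum a (toList (replicate k a)) ≡ k ×ᵐ ⟦ linkPairExpr a a ⟧
  linkSum-replicate zero    a = refl
  linkSum-replicate (suc k) a = cong (⟦ linkPairExpr a a ⟧ +_) (linkSum-replicate k a)

  TI-linear : ∀ k → TIᵛ (replicate (suc k) L1) ≡ (c + g₁₁) + k ×ᵐ g₁₁
  TI-linear k = trans (TI-formula L1 (toList (replicate k L1))) (cong ((c + g₁₁) +_) (linkSum-replicate k L1))

  TI-zigzag : ∀ k → TIᵛ (replicate (suc k) L2) ≡ (c + g₂) + k ×ᵐ g₂₂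
  TI-zigzag k = trans (TI-formula L2 (toList (replicate k L2))) (cong ((c + g₂) +_) (linkSum-replicate k L2))

  -- Both sides are 3 f(3,4) + f(2,4) + f(2,3) + f(3,3).
  g₂+g₂₁≡g₁₁+g₁₂ : g₂ + g₂₁ ≡ g₁₁ + g₁₂
  g₂+g₂₁≡g₁₁+g₁₂ = x∙y⁻¹≈ε⇒x≈y _ _ (sym (trans difference (+-identityˡ _)))
    where
    e = firstLinkExpr L2 ⊕ linkPairExpr L2 L1 ⊖ (linkPairExpr L1 L1 ⊕ linkPairExpr L1 L2)
    difference : 0# ≡ 0# + ⟦ e ⟧
    difference = canonical⇒Σf≡Σf+⟦⟧ f-sym [] [] e refl

  module Maximisers (g₁₂<g₁₁ : g₁₂ < g₁₁) (g₂₂<g₁₁ : g₂₂ < g₁₁) (g₁₂+g₂₁<g₁₁+g₁₁ : g₁₂ + g₂₁ < g₁₁ + g₁₁) where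

    linkSum-L1-bound : ∀ k (v : Vec Link k) → v ≡ replicate k L1 ⊎ linkSum L1 (toList v) < k ×ᵐ g₁₁
    linkSum-L2-bound : ∀ k (v : Vec Link (suc k)) → v ≡ replicate (suc k) L2 ⊎ linkSum L2 (toList v) ≤ g₂₁ + k ×ᵐ g₁₁

    linkSum-L1-bound zero [] = inj₁ refl
    linkSum-L1-bound (suc k) (L1 ∷ v) with linkSum-L1-bound k v
    ... | inj₁ refl = inj₁ refl
    ... | inj₂ lt   = inj₂ (+-monoʳ-< g₁₁ lt)
    linkSum-L1-bound (suc zero) (L2 ∷ []) = inj₂ (+-monoˡ-< 0# g₁₂<g₁₁)
    linkSum-L1-bound (suc (suc k)) (L2 ∷ v) with linkSum-L2-bound k v
    ... | inj₁ refl = inj₂ (+-mono-<-≤ g₁₂<g₁₁ (≤-trans (inj₂ (linkSum-replicate (suc k) L2)) (×ᵐ-monoʳ-≤ (suc k) (inj₁ g₂₂<g₁₁))))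
    ... | inj₂ le   = inj₂ (≤-<-trans (+-monoʳ-≤ g₁₂ le)
                        (<-resp-≡ (+-assoc g₁₂ g₂₁ _) (+-assoc g₁₁ g₁₁ _) (+-monoˡ-< (k ×ᵐ g₁₁) g₁₂+g₂₁<g₁₁+g₁₁)))

    linkSum-L2-bound k (L1 ∷ v) with linkSum-L1-bound k v
    ... | inj₁ refl = inj₂ (inj₂ (cong (g₂₁ +_) (linkSum-replicate k L1)))
    ... | inj₂ lt   = inj₂ (inj₁ (+-monoʳ-< g₂₁ lt))
    linkSum-L2-bound zero (L2 ∷ []) = inj₁ refl
    linkSum-L2-bound (suc k) (L2 ∷ v) with linkSum-L2-bound k v
    ... | inj₁ refl = inj₁ refl
    ... | inj₂ le   = inj₂ (inj₁ (<-resp-≡ refl (x∙yz≈y∙xz g₁₁ g₂₁ _)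
                        (≤-<-trans (+-monoʳ-≤ g₂₂ le) (+-monoˡ-< (g₂₁ + k ×ᵐ g₁₁) g₂₂<g₁₁))))

    linear-zigzag-or-below : ∀ k a (v : Vec Link k) →
      a ∷ v ≡ replicate (suc k) L1 ⊎ a ∷ v ≡ replicate (suc k) L2 ⊎ TIᵛ (a ∷ v) < TIᵛ (replicate (suc k) L1)
    linear-zigzag-or-below k L1 v with linkSum-L1-bound k v
    ... | inj₁ refl = inj₁ refl
    ... | inj₂ lt   = inj₂ (inj₂ (<-resp-≡ (sym (TI-formula L1 (toList v))) (sym (TI-linear k)) (+-monoʳ-< (c + g₁₁) lt)))
    linear-zigzag-or-below zero L2 [] = inj₂ (inj₁ refl)
    linear-zigzag-or-below (suc k) L2 v with linkSum-L2-bound k v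
    ... | inj₁ refl = inj₂ (inj₁ refl)
    ... | inj₂ le   = inj₂ (inj₂ (<-resp-≡ (sym (TI-formula L2 (toList v))) (sym (TI-linear (suc k)))
                        (≤-<-trans (+-monoʳ-≤ (c + g₂) le)
                          (<-resp-≡ (sym regroup₂) (sym regroup₁₁) (+-monoʳ-< c (+-monoˡ-< M (+-monoʳ-< g₁₁ g₁₂<g₁₁)))))))
      where
      M = k ×ᵐ g₁₁
      regroup₂ : (c + g₂) + (g₂₁ + M) ≡ c + ((g₁₁ + g₁₂) + M)
      regroup₂ = begin
        (c + g₂) + (g₂₁ + M)     ≡⟨ +-assoc c g₂ _ ⟩
        c + (g₂ + (g₂₁ + M))     ≡⟨ cong (c +_) (+-assoc g₂ g₂₁ M) ⟨
        c + ((g₂ + g₂₁) + M)     ≡⟨ cong (λ x → c + (x + M)) g₂+g₂₁≡g₁₁+g₁₂ ⟩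
        c + ((g₁₁ + g₁₂) + M)    ∎
      regroup₁₁ : (c + g₁₁) + (g₁₁ + M) ≡ c + ((g₁₁ + g₁₁) + M)
      regroup₁₁ = trans (+-assoc c g₁₁ _) (cong (c +_) (sym (+-assoc g₁₁ g₁₁ M)))

    uniqueMax-if-dominates : ∀ {m} (x₀ : Vec Link m) → (∀ x → x ≡ x₀ ⊎ TIᵛ x < TIᵛ x₀) → UniqueMax F f m x₀
    uniqueMax-if-dominates x₀ dominates x =
      [ (λ x≡x₀ → inj₂ (cong TIᵛ x≡x₀) , λ _ → x≡x₀) , (λ x<x₀ → inj₁ x<x₀ , ⊥-elim ∘ <⇒≢ x<x₀) ] (dominates x)

    linear-uniqueMax : ∀ k → TIᵛ (replicate (suc k) L2) < TIᵛ (replicate (suc k) L1) →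
                       UniqueMax F f (suc k) (replicate (suc k) L1)
    linear-uniqueMax k Z<Li = uniqueMax-if-dominates _ dominated
      where
      dominated : ∀ x → x ≡ replicate (suc k) L1 ⊎ TIᵛ x < TIᵛ (replicate (suc k) L1)
      dominated (a ∷ v) = [ inj₁ , [ (λ is-zigzag → inj₂ (subst (λ x → TIᵛ x < TIᵛ (replicate (suc k) L1)) (sym is-zigzag) Z<Li)) , inj₂ ] ]
                            (linear-zigzag-or-below k a v)

    zigzag-uniqueMax : ∀ k → TIᵛ (replicate (suc k) L1) < TIᵛ (replicate (suc k) L2) →
                       UniqueMax F f (suc k) (replicate (suc k) L2)
    zigzag-uniqueMax k Li<Z = uniqueMax-if-dominates _ dominated
      where
      dominated : ∀ x → x ≡ replicate (suc k) L2 ⊎ TIᵛ x < TIᵛ (replicate (suc k) L2)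
      dominated (a ∷ v) = [ (λ is-linear → inj₂ (subst (λ x → TIᵛ x < TIᵛ (replicate (suc k) L2)) (sym is-linear) Li<Z)) ,
                            [ inj₁ , (λ below → inj₂ (<-trans below Li<Z)) ] ]
                            (linear-zigzag-or-below k a v)

    linear-attainsMax : ∀ k → TIᵛ (replicate (suc k) L2) ≤ TIᵛ (replicate (suc k) L1) →
                        AttainsMax F f (suc k) (replicate (suc k) L1)
    linear-attainsMax k Z≤Li (a ∷ v) =
      [ (λ is-linear → inj₂ (cong TIᵛ is-linear)) ,
        [ (λ is-zigzag → subst (λ x → TIᵛ x ≤ TIᵛ (replicate (suc k) L1)) (sym is-zigzag) Z≤Li) , inj₁ ] ]
      (linear-zigzag-or-below k a v)

    Δ ν ρ : Carrier
    Δ = g₁₁ - g₂₂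
    ν = g₂ - g₁₁
    ρ = ν * Δ ⁻¹

    0<Δ : 0# < Δ
    0<Δ = x<y⇒0<y-x g₂₂<g₁₁

    ρ*Δ≡ν : ρ * Δ ≡ ν
    ρ*Δ≡ν = begin
      ν * Δ ⁻¹ * Δ     ≡⟨ *-assoc ν _ _ ⟩
      ν * (Δ ⁻¹ * Δ)   ≡⟨ cong (ν *_) (*-comm _ _) ⟩
      ν * (Δ * Δ ⁻¹)   ≡⟨ cong (ν *_) (⁻¹-inverse Δ (<⇒≢ 0<Δ ∘ sym)) ⟩
      ν * 1#           ≡⟨ *-identityʳ ν ⟩
      ν                ∎

    base : ℕ → Carrier
    base k = (c + g₁₁) + k ×ᵐ g₂₂

    TI-linear-gap : ∀ k → TIᵛ (replicate (suc k) L1) ≡ base k + k ×ᵐ Δ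
    TI-linear-gap k = begin
      TIᵛ (replicate (suc k) L1)         ≡⟨ TI-linear k ⟩
      (c + g₁₁) + k ×ᵐ g₁₁               ≡⟨ cong (λ x → (c + g₁₁) + k ×ᵐ x) (//-rightDividesˡ g₂₂ g₁₁) ⟨
      (c + g₁₁) + k ×ᵐ (Δ + g₂₂)         ≡⟨ cong ((c + g₁₁) +_) (×ᵐ-distrib-+ Δ g₂₂ k) ⟩
      (c + g₁₁) + (k ×ᵐ Δ + k ×ᵐ g₂₂)    ≡⟨ x∙yz≈xz∙y _ _ _ ⟩
      base k + k ×ᵐ Δ                    ∎

    TI-zigzag-gap : ∀ k → TIᵛ (replicate (suc k) L2) ≡ base k + ν
    TI-zigzag-gap k = begin
      TIᵛ (replicate (suc k) L2)         ≡⟨ TI-zigzag k ⟩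
      (c + g₂) + k ×ᵐ g₂₂                ≡⟨ cong (λ x → (c + x) + k ×ᵐ g₂₂) (//-rightDividesˡ g₁₁ g₂) ⟨
      (c + (ν + g₁₁)) + k ×ᵐ g₂₂         ≡⟨ cong (_+ k ×ᵐ g₂₂) (x∙yz≈xz∙y c ν g₁₁) ⟩
      ((c + g₁₁) + ν) + k ×ᵐ g₂₂         ≡⟨ xy∙z≈xz∙y _ _ _ ⟩
      base k + ν                         ∎

    linear<zigzag : ∀ k → fromℕ k < ρ → TIᵛ (replicate (suc k) L1) < TIᵛ (replicate (suc k) L2)
    linear<zigzag k k<ρ = <-resp-≡ (sym (TI-linear-gap k)) (sym (TI-zigzag-gap k))
      (+-monoʳ-< (base k) (<-resp-≡ (fromℕ-* k Δ) ρ*Δ≡ν (*-monoˡ-< 0<Δ k<ρ)))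

    zigzag<linear : ∀ k → ρ < fromℕ k → TIᵛ (replicate (suc k) L2) < TIᵛ (replicate (suc k) L1)
    zigzag<linear k ρ<k = <-resp-≡ (sym (TI-zigzag-gap k)) (sym (TI-linear-gap k))
      (+-monoʳ-< (base k) (<-resp-≡ ρ*Δ≡ν (fromℕ-* k Δ) (*-monoˡ-< 0<Δ ρ<k)))

    zigzag≤linear : ∀ k → ρ ≤ fromℕ k → TIᵛ (replicate (suc k) L2) ≤ TIᵛ (replicate (suc k) L1)
    zigzag≤linear k (inj₁ ρ<k) = inj₁ (zigzag<linear k ρ<k)
    zigzag≤linear k (inj₂ ρ≡k) = inj₂ (trans (TI-zigzag-gap k) (trans (cong (base k +_) ν≡kΔ) (sym (TI-linear-gap k))))
      where
      ν≡kΔ : ν ≡ k ×ᵐ Δ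
      ν≡kΔ = trans (sym ρ*Δ≡ν) (trans (cong (_* Δ) ρ≡k) (fromℕ-* k Δ))

    linear-unique-if-g₂<g₁₁ : g₂ < g₁₁ → ∀ n → 3 ℕ.≤ n → UniqueMax F f (n ∸ 2) (Li n)
    linear-unique-if-g₂<g₁₁ g₂<g₁₁ (suc (suc (suc k))) (s≤s (s≤s (s≤s z≤n))) =
      linear-uniqueMax k (<-resp-≡ (sym (TI-zigzag k)) (sym (TI-linear k))
        (+-mono-<-≤ (+-monoʳ-< c g₂<g₁₁) (×ᵐ-monoʳ-≤ k (inj₁ g₂₂<g₁₁))))

    linear-unique-if-g₁₁≡g₂ : g₁₁ ≡ g₂ →
      (∀ n → 4 ℕ.≤ n → UniqueMax F f (n ∸ 2) (Li n)) × (TI F f (L2 ∷ []) ≡ TI F f (L1 ∷ []))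
    linear-unique-if-g₁₁≡g₂ g₁₁≡g₂ =
      longer , trans (TI-formula L2 []) (trans (cong (λ x → (c + x) + 0#) (sym g₁₁≡g₂)) (sym (TI-formula L1 [])))
      where
      longer : ∀ n → 4 ℕ.≤ n → UniqueMax F f (n ∸ 2) (Li n)
      longer (suc (suc (suc (suc k)))) (s≤s (s≤s (s≤s (s≤s z≤n)))) =
        linear-uniqueMax (suc k) (<-resp-≡ (sym (TI-zigzag (suc k))) (sym (TI-linear (suc k)))
          (+-mono-≤-< (inj₂ (cong (c +_) (sym g₁₁≡g₂))) (×ᵐ-monoʳ-< k g₂₂<g₁₁)))

    zigzag-then-linear-if-g₁₁<g₂ : g₁₁ < g₂ → ∀ nstar → IsCeiling F (ρ + fromℕ 3) nstar →
      (∀ n → 3 ℕ.≤ n → n ℕ.< nstar → UniqueMax F f (n ∸ 2) (Z n))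
      × AttainsMax F f (nstar ∸ 2) (Li nstar)
      × (∀ n → nstar ℕ.< n → UniqueMax F f (n ∸ 2) (Li n))
    zigzag-then-linear-if-g₁₁<g₂ g₁₁<g₂ nstar ceiling =
      before , at nstar (ℕ.<⇒≤ 3<nstar) ceiling , λ n nstar<n → after n (ℕ.<⇒≤ (ℕ.<-trans 3<nstar nstar<n)) nstar<n
      where
      3<ρ+3 : fromℕ 3 < ρ + fromℕ 3
      3<ρ+3 = <-resp-≡ (+-identityˡ _) refl (+-monoˡ-< (fromℕ 3) (*-pos (x<y⇒0<y-x g₁₁<g₂) (⁻¹-pos 0<Δ)))
      3<nstar : 3 ℕ.< nstar
      3<nstar = fromℕ-cancel-< (<-≤-trans 3<ρ+3 (proj₂ ceiling))
      before : ∀ n → 3 ℕ.≤ n → n ℕ.< nstar → UniqueMax F f (n ∸ 2) (Z n)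
      before (suc (suc (suc k))) (s≤s (s≤s (s≤s z≤n))) n<nstar =
        zigzag-uniqueMax k (linear<zigzag k (+-cancelˡ-< (fromℕ 3) (<-resp-≡ (fromℕ-3+ k) refl (below-ceiling ceiling n<nstar))))
      at : ∀ m → 3 ℕ.≤ m → IsCeiling F (ρ + fromℕ 3) m → AttainsMax F f (m ∸ 2) (Li m)
      at (suc (suc (suc k))) (s≤s (s≤s (s≤s z≤n))) (_ , ρ+3≤m) =
        linear-attainsMax k (zigzag≤linear k (+-cancelˡ-≤ (fromℕ 3) (≤-trans ρ+3≤m (inj₂ (fromℕ-3+ k)))))
      after : ∀ n → 3 ℕ.≤ n → nstar ℕ.< n → UniqueMax F f (n ∸ 2) (Li n)
      after (suc (suc (suc k))) (s≤s (s≤s (s≤s z≤n))) nstar<n =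
        linear-uniqueMax k (zigzag<linear k (+-cancelˡ-< (fromℕ 3) (<-resp-≡ refl (fromℕ-3+ k) (above-ceiling ceiling nstar<n))))

proposition1 : (F : OrderedField) → let open OrderedField F in
    (f : ℕ → ℕ → Carrier) → (∀ a b → f a b ≡ f b a) →
    g12 F f < g11 F f → g22 F f < g11 F f →
    (g12 F f + g21 F f) * (1# + 1#) ⁻¹ < g11 F f →
    -- (a)
    (g2 F f < g11 F f → ∀ n → 3 ℕ.≤ n → UniqueMax F f (n ∸ 2) (Li n))
    ×
    -- (b)
    (g11 F f ≡ g2 F f →
      (∀ n → 4 ℕ.≤ n → UniqueMax F f (n ∸ 2) (Li n))
      × (TI F f (L2 ∷ []) ≡ TI F f (L1 ∷ [])))
    ×
    -- (c)
    (g11 F f < g2 F f → ∀ (nstar : ℕ) →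
      IsCeiling F ((g2 F f - g11 F f) * (g11 F f - g22 F f) ⁻¹ + fromℕ 3) nstar →
      (∀ n → 3 ℕ.≤ n → n ℕ.< nstar → UniqueMax F f (n ∸ 2) (Z n))
      × AttainsMax F f (nstar ∸ 2) (Li nstar)
      × (∀ n → nstar ℕ.< n → UniqueMax F f (n ∸ 2) (Li n)))
proposition1 F f f-sym g12<g11 g22<g11 average<g11 =
  linear-unique-if-g₂<g₁₁ , linear-unique-if-g₁₁≡g₂ , zigzag-then-linear-if-g₁₁<g₂
  where open Extremal.Maximisers F f f-sym g12<g11 g22<g11 (OrderedFieldProperties.x*½<y⇒x<y+y F average<g11)
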